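{- Let $(W,S)$ be a Coxeter system with $|S|<\infty$ and $\theta:W\to W$ a group automorphism with $\theta^2=\mathrm{id}$ and $\theta(S)=S$. If $w\in\{y\theta(y^{ -1})\mid y\in W\}$, then there exists $x\in W$ such that $w=x\theta(x^{ -1})$ and $\ell(w)=2\ell(x)$.
   Context: $\ell$ denotes the Coxeter length function of $(W,S)$. -}

module Defs where

open import Data.Nat using (ℕ; zero; suc; _*_; _≤_)
open import Data.Fin using (Fin)
open import Data.List using (List; []; _∷_; _++_; reverse; length)
open import Data.Product using (Σ; ∃; _×_; _,_)
open import Data.Sum using (_⊎_)
open import Relation.Binary.PropositionalEquality using (_≡_; _≢_)

-- A Coxeter matrix on the finite set S = Fin n.
-- Convention: the entry 0 encodes m(s,t) = ∞ (no relation); this is harmless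
-- since the relator (st)^0 is the empty word.
record CoxeterMatrix (n : ℕ) : Set where
  field
    m     : Fin n → Fin n → ℕ
    m-diag : ∀ s → m s s ≡ 1
    m-sym  : ∀ s t → m s t ≡ m t s
    m-off  : ∀ s t → s ≢ t → (m s t ≡ 0) ⊎ (2 ≤ m s t)

Word : ℕ → Set
Word n = List (Fin n)

alt : ∀ {n} → Fin n → Fin n → ℕ → Word n
alt s t zero    = []
alt s t (suc k) = s ∷ alt t s k

relator : ∀ {n} → CoxeterMatrix n → Fin n → Fin n → Word n
relator M s t = alt s t (2 * CoxeterMatrix.m M s t)

-- W is the setoid (Word n, _≈_ M); product is _++_, identity [], inverse reverse.
data _⊢_≈_ {n : ℕ} (M : CoxeterMatrix n) : Word n → Word n → Set where
  rel   : ∀ u v s t → M ⊢ (u ++ (relator M s t ++ v)) ≈ (u ++ v)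
  ≈refl  : ∀ {u} → M ⊢ u ≈ u
  ≈sym   : ∀ {u v} → M ⊢ u ≈ v → M ⊢ v ≈ u
  ≈trans : ∀ {u v w} → M ⊢ u ≈ v → M ⊢ v ≈ w → M ⊢ u ≈ w

inv : ∀ {n} → Word n → Word n
inv = reverse

record IsAutomorphism {n : ℕ} (M : CoxeterMatrix n) (θ : Word n → Word n) : Set where
  field
    cong-θ : ∀ {u v} → M ⊢ u ≈ v → M ⊢ θ u ≈ θ v
    hom    : ∀ u v → M ⊢ θ (u ++ v) ≈ (θ u ++ θ v)
    inj    : ∀ u v → M ⊢ θ u ≈ θ v → M ⊢ u ≈ v
    surj   : ∀ v → ∃ λ u → M ⊢ θ u ≈ v

PreservesS : ∀ {n} → CoxeterMatrix n → (Word n → Word n) → Set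
PreservesS {n} M θ =
  (∀ (s : Fin n) → ∃ λ (t : Fin n) → M ⊢ θ (s ∷ []) ≈ (t ∷ []))
  × (∀ (t : Fin n) → ∃ λ (s : Fin n) → M ⊢ θ (s ∷ []) ≈ (t ∷ []))

IsLength : ∀ {n} → CoxeterMatrix n → Word n → ℕ → Set
IsLength M w k =
  (∃ λ u → (M ⊢ u ≈ w) × (length u ≡ k)) × (∀ u → M ⊢ u ≈ w → k ≤ length u)

module Submission where

-- By induction on ℓ(w). If w = y θ(y⁻¹) ≠ 1, pick s with ℓ(s w) < ℓ(w). Then s w θ(s) = (s y) θ((s y)⁻¹),
-- and it is two shorter than w: otherwise w α_{θ(s)} = μ α_s with μ ≤ 0 in the geometric representation,
-- so the roots θ(y⁻¹) α_{θ(s)} and y⁻¹ α_s would have opposite signs, while θ preserves lengths and hence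
-- the signs of roots. The inductive hypothesis for s w θ(s) gives x′, and x = s x′ works for w, because
-- ℓ(w) ≤ 2 ℓ(x) ≤ 2 ℓ(x′) + 2 = ℓ(w).
--
-- The geometric representation is built over a ring obtained from ℤ by adjoining the numbers 2cos(π/m) one
-- at a time as roots of Chebyshev polynomials, ordered by the cone of nonnegative coordinates in the
-- Chebyshev basis. Deodhar's dihedral argument shows that every root is nonnegative or nonpositive; this
-- makes the representation faithful, the word problem decidable and the length function computable.

open import Defs
open import Level using (0ℓ)
open import Algebra.Bundles using (CommutativeRing)
open import Algebra.Solver.Ring.AlmostCommutativeRing
  using (fromCommutativeRing; _-Raw-AlmostCommutative⟶_)
open import Data.Nat as ℕ using (ℕ; zero; suc; _<_; _≤_; _∸_; _⊔_; z≤n; s≤s; parity)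
import Data.Nat.Properties as ℕ
open import Data.Integer as ℤ using (ℤ; +_; -[1+_]; _⊖_; _◃_; +≤+; 0ℤ)
import Data.Integer.Properties as ℤ
import Data.Sign as Sign
open import Data.Parity.Base as ℙ using (0ℙ)
import Data.Parity.Properties as ℙ
open import Data.Fin as Fin using (Fin)
import Data.Fin.Properties as Fin
open import Data.List using (List; []; _∷_; _++_; [_]; length; reverse; map; _∷ʳ_; initLast; _∷ʳ′_)
open import Data.List.Properties
  using (++-assoc; ++-identityʳ; reverse-++; reverse-involutive; unfold-reverse; reverse-map;
         length-++; length-reverse; length-map)
open import Data.Maybe using (Maybe; just; nothing)
open import Data.Product using (Σ; ∃; _,_; _×_; proj₁; proj₂)
open import Data.Sum as ⊎ using (_⊎_; inj₁; inj₂)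
open import Data.Empty using (⊥; ⊥-elim)
open import Function using (_∘_)
open import Relation.Nullary using (¬_; Dec; yes; no)
open import Relation.Nullary.Decidable using (map′)
open import Relation.Unary using (Decidable)
open import Relation.Binary.PropositionalEquality as ≡ using (_≡_; _≢_)

module ℤ-CoefficientSolver (R : CommutativeRing 0ℓ 0ℓ) where
  open CommutativeRing R
  open import Algebra.Properties.Ring ring
    using (-0#≈0#; -‿involutive; -‿distribˡ-*; -‿distribʳ-*; -‿+-comm)
  open import Algebra.Properties.Semiring.Mult semiring using (×-homo-+; ×1-homo-*) renaming (_×_ to _×ₙ_)
  open import Relation.Binary.Reasoning.Setoid setoid

  ⟦_⟧ℤ : ℤ → Carrier
  ⟦ + n ⟧ℤ = n ×ₙ 1#
  ⟦ -[1+ n ] ⟧ℤ = - (suc n ×ₙ 1#)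

  private
    nat : ℕ → Carrier
    nat n = n ×ₙ 1#

    x-y≈[a+x]-[a+y] : ∀ a x y → x + - y ≈ (a + x) + - (a + y)
    x-y≈[a+x]-[a+y] a x y = begin
      x + - y                    ≈⟨ +-congʳ (+-identityˡ x) ⟨
      (0# + x) + - y             ≈⟨ +-congʳ (+-congʳ (-‿inverseʳ a)) ⟨
      ((a + - a) + x) + - y      ≈⟨ +-congʳ (+-assoc a (- a) x) ⟩
      (a + (- a + x)) + - y      ≈⟨ +-congʳ (+-congˡ (+-comm (- a) x)) ⟩
      (a + (x + - a)) + - y      ≈⟨ +-congʳ (+-assoc a x (- a)) ⟨
      ((a + x) + - a) + - y      ≈⟨ +-assoc _ _ _ ⟩
      (a + x) + (- a + - y)      ≈⟨ +-congˡ (-‿+-comm a y) ⟩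
      (a + x) + - (a + y)        ∎

    a+[a+[x+y]]≈[a+x]+[a+y] : ∀ a x y → a + (a + (x + y)) ≈ (a + x) + (a + y)
    a+[a+[x+y]]≈[a+x]+[a+y] a x y = begin
      a + (a + (x + y))   ≈⟨ +-congˡ (+-assoc a x y) ⟨
      a + ((a + x) + y)   ≈⟨ +-congˡ (+-congʳ (+-comm a x)) ⟩
      a + ((x + a) + y)   ≈⟨ +-congˡ (+-assoc x a y) ⟩
      a + (x + (a + y))   ≈⟨ +-assoc a x _ ⟨
      (a + x) + (a + y)   ∎

    ⊖-homo : ∀ m n → ⟦ m ⊖ n ⟧ℤ ≈ nat m + - nat n
    ⊖-homo m zero = sym (trans (+-congˡ -0#≈0#) (+-identityʳ _))
    ⊖-homo zero (suc n) = sym (+-identityˡ _)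
    ⊖-homo (suc m) (suc n) = begin
      ⟦ suc m ⊖ suc n ⟧ℤ             ≡⟨ ≡.cong ⟦_⟧ℤ (ℤ.[1+m]⊖[1+n]≡m⊖n m n) ⟩
      ⟦ m ⊖ n ⟧ℤ                     ≈⟨ ⊖-homo m n ⟩
      nat m + - nat n                ≈⟨ x-y≈[a+x]-[a+y] 1# (nat m) (nat n) ⟩
      nat (suc m) + - nat (suc n)    ∎

    +◃-homo : ∀ n → ⟦ Sign.+ ◃ n ⟧ℤ ≈ nat n
    +◃-homo zero = refl
    +◃-homo (suc n) = refl

    -◃-homo : ∀ n → ⟦ Sign.- ◃ n ⟧ℤ ≈ - nat n
    -◃-homo zero = sym -0#≈0#
    -◃-homo (suc n) = refl

    +-homo : ∀ i j → ⟦ i ℤ.+ j ⟧ℤ ≈ ⟦ i ⟧ℤ + ⟦ j ⟧ℤ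
    +-homo (+ m) (+ n) = ×-homo-+ 1# m n
    +-homo (+ m) -[1+ n ] = ⊖-homo m (suc n)
    +-homo -[1+ m ] (+ n) = trans (⊖-homo n (suc m)) (+-comm _ _)
    +-homo -[1+ m ] -[1+ n ] = begin
      - (1# + nat (suc (m ℕ.+ n)))           ≈⟨ -‿cong (+-congˡ (+-congˡ (×-homo-+ 1# m n))) ⟩
      - (1# + (1# + (nat m + nat n)))        ≈⟨ -‿cong (a+[a+[x+y]]≈[a+x]+[a+y] 1# (nat m) (nat n)) ⟩
      - (nat (suc m) + nat (suc n))          ≈⟨ -‿+-comm _ _ ⟨
      - nat (suc m) + - nat (suc n)          ∎

    *-homo : ∀ i j → ⟦ i ℤ.* j ⟧ℤ ≈ ⟦ i ⟧ℤ * ⟦ j ⟧ℤ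
    *-homo (+ m) (+ n) = trans (+◃-homo (m ℕ.* n)) (×1-homo-* m n)
    *-homo (+ m) -[1+ n ] = begin
      ⟦ Sign.- ◃ (m ℕ.* suc n) ⟧ℤ     ≈⟨ -◃-homo (m ℕ.* suc n) ⟩
      - nat (m ℕ.* suc n)             ≈⟨ -‿cong (×1-homo-* m (suc n)) ⟩
      - (nat m * nat (suc n))         ≈⟨ -‿distribʳ-* _ _ ⟩
      nat m * - nat (suc n)           ∎
    *-homo -[1+ m ] (+ n) = begin
      ⟦ Sign.- ◃ (suc m ℕ.* n) ⟧ℤ     ≈⟨ -◃-homo (suc m ℕ.* n) ⟩
      - nat (suc m ℕ.* n)             ≈⟨ -‿cong (×1-homo-* (suc m) n) ⟩
      - (nat (suc m) * nat n)         ≈⟨ -‿distribˡ-* _ _ ⟩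
      - nat (suc m) * nat n           ∎
    *-homo -[1+ m ] -[1+ n ] = begin
      ⟦ Sign.+ ◃ (suc m ℕ.* suc n) ⟧ℤ       ≈⟨ +◃-homo (suc m ℕ.* suc n) ⟩
      nat (suc m ℕ.* suc n)                 ≈⟨ ×1-homo-* (suc m) (suc n) ⟩
      nat (suc m) * nat (suc n)             ≈⟨ -‿involutive _ ⟨
      - - (nat (suc m) * nat (suc n))       ≈⟨ -‿cong (-‿distribʳ-* _ _) ⟩
      - (nat (suc m) * - nat (suc n))       ≈⟨ -‿distribˡ-* _ _ ⟩
      - nat (suc m) * - nat (suc n)         ∎

    -‿homo : ∀ i → ⟦ ℤ.- i ⟧ℤ ≈ - ⟦ i ⟧ℤ
    -‿homo (+ zero) = sym -0#≈0#
    -‿homo (+ suc n) = refl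
    -‿homo -[1+ n ] = sym (-‿involutive _)

  ⟦⟧ℤ-morphism : ℤ.+-*-rawRing -Raw-AlmostCommutative⟶ fromCommutativeRing R
  ⟦⟧ℤ-morphism = record
    { ⟦_⟧ = ⟦_⟧ℤ
    ; +-homo = +-homo
    ; *-homo = *-homo
    ; -‿homo = -‿homo
    ; 0-homo = refl
    ; 1-homo = +-identityʳ 1#
    }

  private
    ≡-weaklyDecidable : ∀ i j → Maybe (⟦ i ⟧ℤ ≈ ⟦ j ⟧ℤ)
    ≡-weaklyDecidable i j with i ℤ.≟ j
    ... | yes ≡.refl = just refl
    ... | no _ = nothing

  open import Algebra.Solver.Ring ℤ.+-*-rawRing (fromCommutativeRing R) ⟦⟧ℤ-morphism ≡-weaklyDecidable public

record ConeRing : Set₁ where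
  field
    commutativeRing : CommutativeRing 0ℓ 0ℓ
  open CommutativeRing commutativeRing public
  field
    _≟_ : ∀ x y → Dec (x ≈ y)
    Nonneg : Carrier → Set
    Nonneg-resp : ∀ {x y} → x ≈ y → Nonneg x → Nonneg y
    0-nonneg : Nonneg 0#
    1-nonneg : Nonneg 1#
    +-nonneg : ∀ {x y} → Nonneg x → Nonneg y → Nonneg (x + y)
    *-nonneg : ∀ {x y} → Nonneg x → Nonneg y → Nonneg (x * y)
    nonneg-antisym : ∀ {x} → Nonneg x → Nonneg (- x) → x ≈ 0#
    1≉0 : ¬ (1# ≈ 0#)

double : ℕ → ℕ
double zero = zero
double (suc k) = suc (suc (double k))

double≡+ : ∀ k → double k ≡ k ℕ.+ k
double≡+ zero = ≡.refl
double≡+ (suc k) = ≡.cong suc (≡.trans (≡.cong suc (double≡+ k)) (≡.sym (ℕ.+-suc k k)))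

module Chebyshev (R : CommutativeRing 0ℓ 0ℓ) where
  open CommutativeRing R hiding (zero)
  open import Algebra.Properties.Ring ring using (-0#≈0#)
  open ℤ-CoefficientSolver R using (solve; _:+_; _:*_; _:-_; _:=_)
  open import Relation.Binary.Reasoning.Setoid setoid

  sumBelow : ℕ → (ℕ → Carrier) → Carrier
  sumBelow zero f = 0#
  sumBelow (suc k) f = sumBelow k f + f k

  x-0≈x : ∀ x → x + - 0# ≈ x
  x-0≈x x = trans (+-congˡ -0#≈0#) (+-identityʳ x)

  -- U k is U_k(c/2) in the usual normalisation, so sin((k+1)φ)/sin φ at c = 2cos φ.
  module _ (c : Carrier) where

    U : ℕ → Carrier
    U zero = 1#
    U (suc zero) = c
    U (suc (suc k)) = c * U (suc k) + - U k

    Upred : ℕ → Carrier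
    Upred zero = 0#
    Upred (suc k) = U k

    U-suc : ∀ k → U (suc k) ≈ c * U k + - Upred k
    U-suc zero = sym (trans (x-0≈x _) (*-identityʳ c))
    U-suc (suc k) = refl

    U-+ : ∀ a b → U a * U b + - (Upred a * Upred b) ≈ U (a ℕ.+ b)
    U-+ zero b = trans (+-cong (*-identityˡ _) (-‿cong (zeroˡ _))) (x-0≈x _)
    U-+ (suc a) b = begin
      U (suc a) * U b + - (U a * Upred b)              ≈⟨ +-congʳ (*-congʳ (U-suc a)) ⟩
      (c * U a + - Upred a) * U b + - (U a * Upred b)  ≈⟨ shift-c (U a) (Upred a) (U b) (Upred b) ⟩
      U a * (c * U b + - Upred b) + - (Upred a * U b)  ≈⟨ +-congʳ (*-congˡ (U-suc b)) ⟨
      U a * U (suc b) + - (Upred a * Upred (suc b))    ≈⟨ U-+ a (suc b) ⟩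
      U (a ℕ.+ suc b)                                  ≡⟨ ≡.cong U (ℕ.+-suc a b) ⟩
      U (suc (a ℕ.+ b))                                ∎
      where
      shift-c : ∀ x x′ y y′ → (c * x + - x′) * y + - (x * y′) ≈ x * (c * y + - y′) + - (x′ * y)
      shift-c = solve 5 (λ c x x′ y y′ → (c :* x :- x′) :* y :- x :* y′ := x :* (c :* y :- y′) :- x′ :* y) refl c

    U-cassini : ∀ k → U k * U k + - (Upred k * U (suc k)) ≈ 1#
    U-cassini zero = trans (+-cong (*-identityˡ _) (-‿cong (zeroˡ _))) (x-0≈x _)
    U-cassini (suc k) = begin
      U (suc k) * U (suc k) + - (U k * (c * U (suc k) + - U k))     ≈⟨ regroup (U (suc k)) (U k) ⟩
      U (suc k) * (U (suc k) + - (c * U k)) + U k * U k              ≈⟨ +-congʳ (*-congˡ (+-congʳ (U-suc k))) ⟩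
      U (suc k) * ((c * U k + - Upred k) + - (c * U k)) + U k * U k  ≈⟨ cancel (U (suc k)) (U k) (Upred k) ⟩
      U k * U k + - (Upred k * U (suc k))                            ≈⟨ U-cassini k ⟩
      1#                                                             ∎
      where
      regroup : ∀ x y → x * x + - (y * (c * x + - y)) ≈ x * (x + - (c * y)) + y * y
      regroup = solve 3 (λ c x y → x :* x :- y :* (c :* x :- y) := x :* (x :- c :* y) :+ y :* y) refl c
      cancel : ∀ x y z → x * ((c * y + - z) + - (c * y)) + y * y ≈ y * y + - (z * x)
      cancel = solve 4 (λ c x y z → x :* ((c :* y :- z) :- c :* y) :+ y :* y := y :* y :- z :* x) refl c

    private
      y+[x-y]≈x : ∀ x y → y + (x + - y) ≈ x
      y+[x-y]≈x = solve 2 (λ x y → y :+ (x :- y) := x) refl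

    sum-U-even : ∀ j → sumBelow j (λ i → U (double i)) ≈ Upred j * Upred j
    sum-U-even zero = sym (zeroˡ _)
    sum-U-even (suc j) = begin
      sumBelow j (λ i → U (double i)) + U (double j)                ≈⟨ +-cong (sum-U-even j) (reflexive (≡.cong U (double≡+ j))) ⟩
      Upred j * Upred j + U (j ℕ.+ j)                                ≈⟨ +-congˡ (U-+ j j) ⟨
      Upred j * Upred j + (U j * U j + - (Upred j * Upred j))        ≈⟨ y+[x-y]≈x _ _ ⟩
      U j * U j                                                      ∎

    sum-U-odd : ∀ j → sumBelow j (λ i → U (suc (double i))) ≈ U j * Upred j
    sum-U-odd zero = sym (zeroʳ _)
    sum-U-odd (suc j) = begin
      sumBelow j (λ i → U (suc (double i))) + U (suc (double j))    ≈⟨ +-cong (sum-U-odd j) (reflexive (≡.cong (U ∘ suc) (double≡+ j))) ⟩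
      U j * Upred j + U (suc j ℕ.+ j)                                ≈⟨ +-congˡ (U-+ (suc j) j) ⟨
      U j * Upred j + (U (suc j) * U j + - (U j * Upred j))          ≈⟨ y+[x-y]≈x _ _ ⟩
      U (suc j) * U j                                                ∎

    sum-Upred-even : ∀ j → sumBelow (suc j) (λ i → Upred (double i)) ≈ U j * Upred j
    sum-Upred-even zero = trans (+-identityˡ _) (sym (zeroʳ _))
    sum-Upred-even (suc j) = begin
      sumBelow (suc j) (λ i → Upred (double i)) + U (suc (double j)) ≈⟨ +-cong (sum-Upred-even j) (reflexive (≡.cong (U ∘ suc) (double≡+ j))) ⟩
      U j * Upred j + U (suc j ℕ.+ j)                                ≈⟨ +-congˡ (U-+ (suc j) j) ⟨
      U j * Upred j + (U (suc j) * U j + - (U j * Upred j))          ≈⟨ y+[x-y]≈x _ _ ⟩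
      U (suc j) * U j                                                ∎

module _ (K : ConeRing) where
  open ConeRing K
  open Chebyshev commutativeRing using (U)

  -- a behaves like 2cos(π/m): this is all the geometric representation needs of it.
  record IsTwoCosPiOver (m : ℕ) (a : Carrier) : Set where
    field
      U-root : U a (ℕ.pred m) ≈ 0#
      U-nonneg : ∀ j → j < ℕ.pred m → Nonneg (U a j)

module ChebyshevNonneg (K : ConeRing) where
  open ConeRing K
  open import Relation.Binary.Reasoning.Setoid setoid
  open Chebyshev commutativeRing using (U; Upred)
  open ℤ-CoefficientSolver commutativeRing using (solve; _:+_; _:-_; _:=_)

  U-nonneg-at-two : ∀ {a} → a ≈ 1# + 1# → ∀ k → Nonneg (U a k) × Nonneg (Upred a k)
  U-nonneg-at-two {a} a≈2 zero = 1-nonneg , 0-nonneg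
  U-nonneg-at-two {a} a≈2 (suc k) =
    Nonneg-resp (sym (U-suc≈U+1 k)) (+-nonneg (proj₁ (U-nonneg-at-two a≈2 k)) 1-nonneg) , proj₁ (U-nonneg-at-two a≈2 k)
    where
    U-suc≈U+1 : ∀ k → U a (suc k) ≈ U a k + 1#
    U-suc≈U+1 zero = trans a≈2 (+-comm _ _)
    U-suc≈U+1 (suc k) = begin
      a * U a (suc k) + - U a k                          ≈⟨ +-congʳ (trans (*-congʳ a≈2) (distribʳ _ _ _)) ⟩
      (1# * U a (suc k) + 1# * U a (suc k)) + - U a k    ≈⟨ +-congʳ (+-cong (*-identityˡ _) (*-identityˡ _)) ⟩
      (U a (suc k) + U a (suc k)) + - U a k              ≈⟨ +-congʳ (+-cong (U-suc≈U+1 k) (U-suc≈U+1 k)) ⟩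
      ((U a k + 1#) + (U a k + 1#)) + - U a k            ≈⟨ cancel (U a k) 1# ⟩
      (U a k + 1#) + 1#                                  ≈⟨ +-congʳ (U-suc≈U+1 k) ⟨
      U a (suc k) + 1#                                   ∎
      where
      cancel : ∀ x o → ((x + o) + (x + o)) + - x ≈ (x + o) + o
      cancel = solve 2 (λ x o → ((x :+ o) :+ (x :+ o)) :- x := (x :+ o) :+ o) refl

  U-nonneg-below : ∀ {m a} → IsTwoCosPiOver K m a → ∀ {k} → k < m → Nonneg (U a k) × Nonneg (Upred a k)
  U-nonneg-below {m} {a} cos {k} k<m = U-nonneg-≤ k (ℕ.pred-mono-≤ k<m) , Upred-nonneg k (ℕ.pred-mono-≤ k<m)
    where
    U-nonneg-≤ : ∀ k → k ≤ ℕ.pred m → Nonneg (U a k)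
    U-nonneg-≤ k k≤m-1 with ℕ.m≤n⇒m<n∨m≡n k≤m-1
    ... | inj₁ k<m-1 = IsTwoCosPiOver.U-nonneg cos k k<m-1
    ... | inj₂ ≡.refl = Nonneg-resp (sym (IsTwoCosPiOver.U-root cos)) 0-nonneg
    Upred-nonneg : ∀ k → k ≤ ℕ.pred m → Nonneg (Upred a k)
    Upred-nonneg zero _ = 0-nonneg
    Upred-nonneg (suc k) k<m-1 = U-nonneg-≤ k (ℕ.<⇒≤ k<m-1)

module ChebyshevExtension (A : ConeRing) (d′ : ℕ) where
  open ConeRing A hiding (zero)
  open import Algebra.Properties.Ring ring using (-1*x≈-x; -‿distribˡ-*)
  open import Algebra.Properties.CommutativeSemigroup +-commutativeSemigroup using (interchange)
  open ℤ-CoefficientSolver commutativeRing using (solve; _:+_; _:*_; _:-_; _:=_)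
  open Chebyshev commutativeRing using (sumBelow; x-0≈x)

  d : ℕ
  d = suc d′

  -- Elements of A[c]/(U_d(c)) are coordinate sequences in the basis U_0(c), …, U_{d-1}(c); coordinates
  -- from d on are ignored by ≋. Multiplication by c is shift, as c U_j = U_{j+1} + U_{j-1} and U_d(c) = 0.
  V : Set
  V = ℕ → Carrier

  infix 4 _≋_
  _≋_ : V → V → Set
  x ≋ y = ∀ i → i < d → x i ≈ y i

  ≋-refl : ∀ {x} → x ≋ x
  ≋-refl i _ = refl

  ≋-sym : ∀ {x y} → x ≋ y → y ≋ x
  ≋-sym p i h = sym (p i h)

  ≋-trans : ∀ {x y z} → x ≋ y → y ≋ z → x ≋ z
  ≋-trans p q i h = trans (p i h) (q i h)

  infixl 6 _⊕_
  infixr 7 _•_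

  _⊕_ : V → V → V
  (x ⊕ y) i = x i + y i

  ⊝ : V → V
  ⊝ x i = - x i

  𝟘 : V
  𝟘 i = 0#

  _•_ : Carrier → V → V
  (r • x) i = r * x i

  ⊕-cong : ∀ {x x′ y y′} → x ≋ x′ → y ≋ y′ → x ⊕ y ≋ x′ ⊕ y′
  ⊕-cong p q i h = +-cong (p i h) (q i h)

  ⊝-cong : ∀ {x x′} → x ≋ x′ → ⊝ x ≋ ⊝ x′
  ⊝-cong p i h = -‿cong (p i h)

  •-cong : ∀ {r r′ x x′} → r ≈ r′ → x ≋ x′ → r • x ≋ r′ • x′
  •-cong p q i h = *-cong p (q i h)

  ⊝≋-1• : ∀ x → ⊝ x ≋ (- 1#) • x
  ⊝≋-1• x i h = sym (-1*x≈-x (x i))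

  e : ℕ → V
  e j i with i ℕ.≟ j
  ... | yes _ = 1#
  ... | no _ = 0#

  e-diag : ∀ j → e j j ≈ 1#
  e-diag j with j ℕ.≟ j
  ... | yes _ = refl
  ... | no j≢j = ⊥-elim (j≢j ≡.refl)

  e-offdiag : ∀ {i j} → ¬ i ≡ j → e j i ≈ 0#
  e-offdiag {i} {j} i≢j with i ℕ.≟ j
  ... | yes i≡j = ⊥-elim (i≢j i≡j)
  ... | no _ = refl

  e-suc : ∀ i j → e (suc j) (suc i) ≈ e j i
  e-suc i j with i ℕ.≟ j | suc i ℕ.≟ suc j
  ... | yes _ | yes _ = refl
  ... | no _ | no _ = refl
  ... | yes i≡j | no i≢j = ⊥-elim (i≢j (≡.cong suc i≡j))
  ... | no i≢j | yes i≡j = ⊥-elim (i≢j (ℕ.suc-injective i≡j))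

  e-d≋𝟘 : e d ≋ 𝟘
  e-d≋𝟘 i i<d = e-offdiag (ℕ.<⇒≢ i<d)

  prev : V → V
  prev x zero = 0#
  prev x (suc i) = x i

  next : V → V
  next x i with suc i ℕ.<? d
  ... | yes _ = x (suc i)
  ... | no _ = 0#

  shift : V → V
  shift x i = prev x i + next x i

  record IsLinear (L : V → V) : Set where
    field
      lin-cong : ∀ {x y} → x ≋ y → L x ≋ L y
      lin-⊕ : ∀ x y → L (x ⊕ y) ≋ L x ⊕ L y
      lin-• : ∀ r x → L (r • x) ≋ r • L x

    lin-𝟘 : L 𝟘 ≋ 𝟘
    lin-𝟘 = ≋-trans (lin-cong (λ i h → sym (zeroˡ 0#))) (≋-trans (lin-• 0# 𝟘) (λ i h → zeroˡ _))

    lin-⊝ : ∀ x → L (⊝ x) ≋ ⊝ (L x)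
    lin-⊝ x = ≋-trans (lin-cong (⊝≋-1• x)) (≋-trans (lin-• (- 1#) x) (≋-sym (⊝≋-1• (L x))))

    lin-sub : ∀ x y → L (x ⊕ ⊝ y) ≋ L x ⊕ ⊝ (L y)
    lin-sub x y = ≋-trans (lin-⊕ x (⊝ y)) (⊕-cong ≋-refl (lin-⊝ y))

  open IsLinear public

  CommutesWithShift : (V → V) → Set
  CommutesWithShift L = ∀ x → L (shift x) ≋ shift (L x)

  id-linear : IsLinear (λ x → x)
  id-linear = record { lin-cong = λ p → p ; lin-⊕ = λ x y → ≋-refl ; lin-• = λ r x → ≋-refl }

  ∘-linear : ∀ {L L′} → IsLinear L → IsLinear L′ → IsLinear (λ x → L (L′ x))
  ∘-linear l l′ = record
    { lin-cong = λ p → lin-cong l (lin-cong l′ p)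
    ; lin-⊕ = λ x y → ≋-trans (lin-cong l (lin-⊕ l′ x y)) (lin-⊕ l _ _)
    ; lin-• = λ r x → ≋-trans (lin-cong l (lin-• l′ r x)) (lin-• l r _)
    }

  shift-linear : IsLinear shift
  shift-linear = record
    { lin-cong = λ p i h → +-cong (prev-cong p i h) (next-cong p i)
    ; lin-⊕ = λ x y i h → trans (+-cong (prev-⊕ x y i) (next-⊕ x y i)) (interchange _ _ _ _)
    ; lin-• = λ r x i h → trans (+-cong (prev-• r x i) (next-• r x i)) (sym (distribˡ r _ _))
    }
    where
    prev-cong : ∀ {x y} → x ≋ y → ∀ i → i < d → prev x i ≈ prev y i
    prev-cong p zero h = refl
    prev-cong p (suc i) h = p i (ℕ.<-trans (ℕ.n<1+n i) h)
    next-cong : ∀ {x y} → x ≋ y → ∀ i → next x i ≈ next y i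
    next-cong p i with suc i ℕ.<? d
    ... | yes h = p (suc i) h
    ... | no _ = refl
    prev-⊕ : ∀ x y i → prev (x ⊕ y) i ≈ prev x i + prev y i
    prev-⊕ x y zero = sym (+-identityʳ _)
    prev-⊕ x y (suc i) = refl
    next-⊕ : ∀ x y i → next (x ⊕ y) i ≈ next x i + next y i
    next-⊕ x y i with suc i ℕ.<? d
    ... | yes _ = refl
    ... | no _ = sym (+-identityʳ _)
    prev-• : ∀ r x i → prev (r • x) i ≈ r * prev x i
    prev-• r x zero = sym (zeroʳ _)
    prev-• r x (suc i) = refl
    next-• : ∀ r x i → next (r • x) i ≈ r * next x i
    next-• r x i with suc i ℕ.<? d
    ... | yes _ = refl
    ... | no _ = sym (zeroʳ _)

  Ushift : ℕ → V → V
  Ushift zero x = x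
  Ushift (suc zero) x = shift x
  Ushift (suc (suc k)) x = shift (Ushift (suc k) x) ⊕ ⊝ (Ushift k x)

  Upredshift : ℕ → V → V
  Upredshift zero x = 𝟘
  Upredshift (suc k) x = Ushift k x

  Ushift-suc : ∀ k x → Ushift (suc k) x ≋ shift (Ushift k x) ⊕ ⊝ (Upredshift k x)
  Ushift-suc zero x i h = sym (x-0≈x _)
  Ushift-suc (suc k) x = ≋-refl

  Ushift-linear : ∀ k → IsLinear (Ushift k)
  Ushift-linear zero = id-linear
  Ushift-linear (suc zero) = shift-linear
  Ushift-linear (suc (suc k)) = record
    { lin-cong = λ p → ⊕-cong (lin-cong shift-linear (lin-cong (Ushift-linear (suc k)) p)) (⊝-cong (lin-cong (Ushift-linear k) p))
    ; lin-⊕ = λ x y → ≋-trans (⊕-cong (≋-trans (lin-cong shift-linear (lin-⊕ (Ushift-linear (suc k)) x y)) (lin-⊕ shift-linear _ _))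
                                       (⊝-cong (lin-⊕ (Ushift-linear k) x y)))
                               (λ i h → [a+b]-[c+e]≈[a-c]+[b-e] _ _ _ _)
    ; lin-• = λ r x → ≋-trans (⊕-cong (≋-trans (lin-cong shift-linear (lin-• (Ushift-linear (suc k)) r x)) (lin-• shift-linear r _))
                                       (⊝-cong (lin-• (Ushift-linear k) r x)))
                               (λ i h → ra-rc≈r[a-c] _ _ _)
    }
    where
    [a+b]-[c+e]≈[a-c]+[b-e] : ∀ a b c e → (a + b) + - (c + e) ≈ (a + - c) + (b + - e)
    [a+b]-[c+e]≈[a-c]+[b-e] = solve 4 (λ a b c e → (a :+ b) :- (c :+ e) := (a :- c) :+ (b :- e)) refl
    ra-rc≈r[a-c] : ∀ r a c → r * a + - (r * c) ≈ r * (a + - c)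
    ra-rc≈r[a-c] = solve 3 (λ r a c → r :* a :- r :* c := r :* (a :- c)) refl

  Upredshift-linear : ∀ k → IsLinear (Upredshift k)
  Upredshift-linear zero = record
    { lin-cong = λ _ → ≋-refl ; lin-⊕ = λ x y i h → sym (+-identityʳ 0#) ; lin-• = λ r x i h → sym (zeroʳ r) }
  Upredshift-linear (suc k) = Ushift-linear k

  Ushift-commutes : ∀ {L} → IsLinear L → CommutesWithShift L → ∀ k x → L (Ushift k x) ≋ Ushift k (L x)
  Ushift-commutes l cs zero x = ≋-refl
  Ushift-commutes l cs (suc zero) x = cs x
  Ushift-commutes l cs (suc (suc k)) x =
    ≋-trans (lin-sub l _ _)
            (⊕-cong (≋-trans (cs _) (lin-cong shift-linear (Ushift-commutes l cs (suc k) x)))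
                    (⊝-cong (Ushift-commutes l cs k x)))

  Ushift-commutes-shift : ∀ k → CommutesWithShift (Ushift k)
  Ushift-commutes-shift k x = ≋-sym (Ushift-commutes shift-linear (λ _ → ≋-refl) k x)

  Ushift-comm : ∀ j k x → Ushift j (Ushift k x) ≋ Ushift k (Ushift j x)
  Ushift-comm j k x = Ushift-commutes (Ushift-linear j) (Ushift-commutes-shift j) k x

  ∑V : ℕ → (ℕ → V) → V
  ∑V k F i = sumBelow k (λ j → F j i)

  sumBelow-cong : ∀ k {f g} → (∀ j → j < k → f j ≈ g j) → sumBelow k f ≈ sumBelow k g
  sumBelow-cong zero p = refl
  sumBelow-cong (suc k) p = +-cong (sumBelow-cong k (λ j h → p j (ℕ.m<n⇒m<1+n h))) (p k (ℕ.n<1+n k))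

  ∑V-cong : ∀ k {F G} → (∀ j → j < k → F j ≋ G j) → ∑V k F ≋ ∑V k G
  ∑V-cong k p i h = sumBelow-cong k (λ j hj → p j hj i h)

  ∑V-⊕ : ∀ k F G → ∑V k (λ j → F j ⊕ G j) ≋ ∑V k F ⊕ ∑V k G
  ∑V-⊕ zero F G i h = sym (+-identityʳ 0#)
  ∑V-⊕ (suc k) F G i h = trans (+-congʳ (∑V-⊕ k F G i h)) (interchange _ _ _ _)

  ∑V-• : ∀ k r F → ∑V k (λ j → r • F j) ≋ r • ∑V k F
  ∑V-• zero r F i h = sym (zeroʳ r)
  ∑V-• (suc k) r F i h = trans (+-congʳ (∑V-• k r F i h)) (sym (distribˡ r _ _))

  ∑V-linear : ∀ {L} → IsLinear L → ∀ k F → L (∑V k F) ≋ ∑V k (λ j → L (F j))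
  ∑V-linear l zero F = lin-𝟘 l
  ∑V-linear l (suc k) F = ≋-trans (lin-⊕ l (∑V k F) (F k)) (⊕-cong (∑V-linear l k F) ≋-refl)

  sum-delta-≥ : ∀ k (f : ℕ → Carrier) i → k ≤ i → sumBelow k (λ j → f j * e j i) ≈ 0#
  sum-delta-≥ zero f i h = refl
  sum-delta-≥ (suc k) f i h =
    trans (+-cong (sum-delta-≥ k f i (ℕ.<⇒≤ h)) (trans (*-congˡ (e-offdiag (ℕ.>⇒≢ h))) (zeroʳ _))) (+-identityʳ 0#)

  sum-delta-< : ∀ k (f : ℕ → Carrier) i → i < k → sumBelow k (λ j → f j * e j i) ≈ f i
  sum-delta-< (suc k) f i i<1+k = split (i ℕ.≟ k)
    where
    split : Dec (i ≡ k) → sumBelow (suc k) (λ j → f j * e j i) ≈ f i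
    split (yes ≡.refl) =
      trans (+-cong (sum-delta-≥ k f i ℕ.≤-refl) (trans (*-congˡ (e-diag i)) (*-identityʳ _))) (+-identityˡ _)
    split (no i≢k) =
      trans (+-cong (sum-delta-< k f i (ℕ.≤∧≢⇒< (ℕ.≤-pred i<1+k) i≢k)) (trans (*-congˡ (e-offdiag i≢k)) (zeroʳ _)))
            (+-identityʳ _)

  expand-basis : ∀ x → x ≋ ∑V d (λ j → x j • e j)
  expand-basis x i h = sym (sum-delta-< d x i h)

  ePred : ℕ → V
  ePred zero = 𝟘
  ePred (suc j) = e j

  shift-e : ∀ j → j < d → shift (e j) ≋ e (suc j) ⊕ ePred j
  shift-e j j<d i _ = +-cong (prev-e i) (next-e j j<d i)
    where
    prev-e : ∀ i → prev (e j) i ≈ e (suc j) i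
    prev-e zero = sym (e-offdiag {0} {suc j} (λ ()))
    prev-e (suc i) = sym (e-suc i j)
    next-e : ∀ j → j < d → ∀ i → next (e j) i ≈ ePred j i
    next-e zero _ i with suc i ℕ.<? d
    ... | yes _ = e-offdiag {suc i} {0} (λ ())
    ... | no _ = refl
    next-e (suc j) j<d i with suc i ℕ.<? d
    ... | yes _ = e-suc i j
    ... | no i+1≮d = sym (e-offdiag (λ i≡j → i+1≮d (≡.subst (λ k → suc k < d) (≡.sym i≡j) j<d)))

  Ushift-e₀ : ∀ j → j ≤ d → Ushift j (e 0) ≋ e j
  Ushift-e₀ zero _ = ≋-refl
  Ushift-e₀ (suc zero) _ = ≋-trans (shift-e 0 (s≤s z≤n)) (λ i _ → +-identityʳ _)
  Ushift-e₀ (suc (suc j)) h =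
    ≋-trans (⊕-cong (≋-trans (lin-cong shift-linear (Ushift-e₀ (suc j) (ℕ.<⇒≤ h))) (shift-e (suc j) h))
                    (⊝-cong (Ushift-e₀ j (ℕ.≤-trans (ℕ.n≤1+n j) (ℕ.<⇒≤ h)))))
            (λ i _ → [a+b]-b≈a _ _)
    where
    [a+b]-b≈a : ∀ a b → (a + b) + - b ≈ a
    [a+b]-b≈a = solve 2 (λ a b → (a :+ b) :- b := a) refl

  infixl 7 _⊛_
  _⊛_ : V → V → V
  x ⊛ y = ∑V d (λ j → x j • Ushift j y)

  ⊛-linear : ∀ x → IsLinear (x ⊛_)
  ⊛-linear x = record
    { lin-cong = λ p → ∑V-cong d (λ j _ → •-cong refl (lin-cong (Ushift-linear j) p))
    ; lin-⊕ = λ y z → ≋-trans (∑V-cong d (λ j _ → ≋-trans (•-cong refl (lin-⊕ (Ushift-linear j) y z))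
                                                            (λ i h → distribˡ _ _ _)))
                               (∑V-⊕ d _ _)
    ; lin-• = λ r y → ≋-trans (∑V-cong d (λ j _ → ≋-trans (•-cong refl (lin-• (Ushift-linear j) r y))
                                                            (λ i h → x[ry]≈r[xy] _ _ _)))
                               (∑V-• d r _)
    }
    where
    x[ry]≈r[xy] : ∀ a r b → a * (r * b) ≈ r * (a * b)
    x[ry]≈r[xy] = solve 3 (λ a r b → a :* (r :* b) := r :* (a :* b)) refl

  ⊛-commutes-shift : ∀ x → CommutesWithShift (x ⊛_)
  ⊛-commutes-shift x y =
    ≋-trans (∑V-cong d (λ j _ → ≋-trans (•-cong refl (Ushift-commutes-shift j y)) (≋-sym (lin-• shift-linear (x j) _))))
            (≋-sym (∑V-linear shift-linear d _))

  ⊛-identityʳ : ∀ x → x ⊛ e 0 ≋ x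
  ⊛-identityʳ x = ≋-trans (∑V-cong d (λ j j<d → •-cong refl (Ushift-e₀ j (ℕ.<⇒≤ j<d)))) (≋-sym (expand-basis x))

  -- Commutativity and associativity of ⊛ both follow from this.
  commuting-linear≋⊛ : ∀ {L} → IsLinear L → CommutesWithShift L → ∀ y → L y ≋ y ⊛ L (e 0)
  commuting-linear≋⊛ {L} l cs y =
    ≋-trans (lin-cong l (expand-basis y))
    (≋-trans (∑V-linear l d _)
    (∑V-cong d (λ j j<d → ≋-trans (lin-• l (y j) (e j))
                           (•-cong refl (≋-trans (lin-cong l (≋-sym (Ushift-e₀ j (ℕ.<⇒≤ j<d))))
                                                 (Ushift-commutes l cs j (e 0)))))))

  ⊛-comm : ∀ x y → x ⊛ y ≋ y ⊛ x
  ⊛-comm x y = ≋-trans (commuting-linear≋⊛ (⊛-linear x) (⊛-commutes-shift x) y) (lin-cong (⊛-linear y) (⊛-identityʳ x))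

  ⊛-assoc : ∀ x y z → (x ⊛ y) ⊛ z ≋ x ⊛ (y ⊛ z)
  ⊛-assoc x y z = ≋-sym (≋-trans (commuting-linear≋⊛ (∘-linear (⊛-linear x) (⊛-linear y)) x⊛y⊛-commutes z)
                                  (≋-trans (lin-cong (⊛-linear z) (lin-cong (⊛-linear x) (⊛-identityʳ y))) (⊛-comm z _)))
    where
    x⊛y⊛-commutes : CommutesWithShift (λ w → x ⊛ (y ⊛ w))
    x⊛y⊛-commutes w = ≋-trans (lin-cong (⊛-linear x) (⊛-commutes-shift y w)) (⊛-commutes-shift x _)

  ⊛-cong : ∀ {x x′ y y′} → x ≋ x′ → y ≋ y′ → x ⊛ y ≋ x′ ⊛ y′
  ⊛-cong {x′ = x′} p q = ≋-trans (∑V-cong d (λ j j<d → •-cong (p j j<d) ≋-refl)) (lin-cong (⊛-linear x′) q)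

  ⊛-distribʳ : ∀ x y z → (y ⊕ z) ⊛ x ≋ y ⊛ x ⊕ z ⊛ x
  ⊛-distribʳ x y z = ≋-trans (⊛-comm _ x) (≋-trans (lin-⊕ (⊛-linear x) y z) (⊕-cong (⊛-comm x y) (⊛-comm x z)))

  commutativeRing′ : CommutativeRing 0ℓ 0ℓ
  commutativeRing′ = record
    { Carrier = V
    ; _≈_ = _≋_
    ; _+_ = _⊕_
    ; _*_ = _⊛_
    ; -_ = ⊝
    ; 0# = 𝟘
    ; 1# = e 0
    ; isCommutativeRing = record
      { isRing = record
        { +-isAbelianGroup = record
          { isGroup = record
            { isMonoid = record
              { isSemigroup = record
                { isMagma = record { isEquivalence = record { refl = ≋-refl ; sym = ≋-sym ; trans = ≋-trans }
                                   ; ∙-cong = ⊕-cong }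
                ; assoc = λ x y z i h → +-assoc _ _ _ }
              ; identity = (λ x i h → +-identityˡ _) , (λ x i h → +-identityʳ _) }
            ; inverse = (λ x i h → -‿inverseˡ _) , (λ x i h → -‿inverseʳ _)
            ; ⁻¹-cong = ⊝-cong }
          ; comm = λ x y i h → +-comm _ _ }
        ; *-cong = ⊛-cong
        ; *-assoc = ⊛-assoc
        ; *-identity = (λ x → ≋-trans (⊛-comm (e 0) x) (⊛-identityʳ x)) , ⊛-identityʳ
        ; distrib = (λ x → lin-⊕ (⊛-linear x)) , ⊛-distribʳ }
      ; *-comm = ⊛-comm }
    }

  NonnegV : V → Set
  NonnegV x = ∀ i → i < d → Nonneg (x i)

  NonnegV-resp : ∀ {x y} → x ≋ y → NonnegV x → NonnegV y
  NonnegV-resp p q i h = Nonneg-resp (p i h) (q i h)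

  𝟘-nonneg : NonnegV 𝟘
  𝟘-nonneg i h = 0-nonneg

  e-nonneg : ∀ j → NonnegV (e j)
  e-nonneg j i h with i ℕ.≟ j
  ... | yes _ = 1-nonneg
  ... | no _ = 0-nonneg

  ⊕-nonneg : ∀ {x y} → NonnegV x → NonnegV y → NonnegV (x ⊕ y)
  ⊕-nonneg p q i h = +-nonneg (p i h) (q i h)

  •-nonneg : ∀ {r x} → Nonneg r → NonnegV x → NonnegV (r • x)
  •-nonneg p q i h = *-nonneg p (q i h)

  ∑V-nonneg : ∀ k {F} → (∀ j → j < k → NonnegV (F j)) → NonnegV (∑V k F)
  ∑V-nonneg zero p i h = 0-nonneg
  ∑V-nonneg (suc k) p i h = +-nonneg (∑V-nonneg k (λ j hj → p j (ℕ.m<n⇒m<1+n hj)) i h) (p k (ℕ.n<1+n k) i h)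

  -- Iterating this writes U_j U_i as a sum of U_k's, so nonnegative coordinates are closed under ⊛.
  Ushift-fusion : ∀ j i y → j ≤ i → Ushift j (Ushift i y) ≋ Ushift (i ∸ j) y ⊕ Upredshift j (Ushift (suc i) y)
  Ushift-fusion zero i y _ _ _ = sym (+-identityʳ _)
  Ushift-fusion (suc j) (suc i) y (s≤s j≤i) =
    ≋-trans (Ushift-suc j (Ushift (suc i) y)) (≋-sym (≋-trans (⊕-cong ≋-refl Uj[Ui+2y]) (λ _ _ → a+[s-[a+m]]≈s-m _ _ _)))
    where
    Uj[Ui+2y] : Ushift j (Ushift (suc (suc i)) y)
                  ≋ shift (Ushift j (Ushift (suc i) y)) ⊕ ⊝ (Ushift (i ∸ j) y ⊕ Upredshift j (Ushift (suc i) y))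
    Uj[Ui+2y] = ≋-trans (lin-cong (Ushift-linear j) (Ushift-suc (suc i) y))
                (≋-trans (lin-sub (Ushift-linear j) _ _)
                (⊕-cong (Ushift-commutes-shift j _) (⊝-cong (Ushift-fusion j i y j≤i))))
    a+[s-[a+m]]≈s-m : ∀ a s m → a + (s + - (a + m)) ≈ s + - m
    a+[s-[a+m]]≈s-m = solve 3 (λ a s m → a :+ (s :- (a :+ m)) := s :- m) refl

  Ushift-e-nonneg-≤ : ∀ j i → j ≤ i → i < d → NonnegV (Ushift j (e i))
  Ushift-e-nonneg-≤ j i j≤i i<d =
    NonnegV-resp (≋-sym (≋-trans (lin-cong (Ushift-linear j) (≋-sym (Ushift-e₀ i (ℕ.<⇒≤ i<d))))
                        (≋-trans (Ushift-fusion j i (e 0) j≤i)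
                                 (⊕-cong (Ushift-e₀ (i ∸ j) (ℕ.≤-trans (ℕ.m∸n≤m i j) (ℕ.<⇒≤ i<d)))
                                         (lin-cong (Upredshift-linear j) (Ushift-e₀ (suc i) i<d))))))
                 (⊕-nonneg (e-nonneg _) (Upredshift-e-nonneg j j≤i))
    where
    Upredshift-e-nonneg : ∀ j → j ≤ i → NonnegV (Upredshift j (e (suc i)))
    Upredshift-e-nonneg zero _ = 𝟘-nonneg
    Upredshift-e-nonneg (suc j) j<i+1 with suc i ℕ.<? d
    ... | yes i+1<d = Ushift-e-nonneg-≤ j (suc i) (ℕ.≤-trans (ℕ.n≤1+n j) (ℕ.≤-trans j<i+1 (ℕ.n≤1+n i))) i+1<d
    ... | no i+1≮d = NonnegV-resp (≋-sym (≋-trans (lin-cong (Ushift-linear j) e[i+1]≋𝟘) (lin-𝟘 (Ushift-linear j)))) 𝟘-nonneg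
      where
      e[i+1]≋𝟘 : e (suc i) ≋ 𝟘
      e[i+1]≋𝟘 k k<d = e-offdiag (λ k≡i+1 → i+1≮d (≡.subst (_< d) k≡i+1 k<d))

  Ushift-e-nonneg : ∀ j i → j < d → i < d → NonnegV (Ushift j (e i))
  Ushift-e-nonneg j i j<d i<d with ℕ.≤-total j i
  ... | inj₁ j≤i = Ushift-e-nonneg-≤ j i j≤i i<d
  ... | inj₂ i≤j =
    NonnegV-resp (≋-sym (≋-trans (lin-cong (Ushift-linear j) (≋-sym (Ushift-e₀ i (ℕ.<⇒≤ i<d))))
                        (≋-trans (Ushift-comm j i (e 0)) (lin-cong (Ushift-linear i) (Ushift-e₀ j (ℕ.<⇒≤ j<d))))))
                 (Ushift-e-nonneg-≤ i j i≤j j<d)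

  Ushift-nonneg : ∀ {y} → NonnegV y → ∀ j → j < d → NonnegV (Ushift j y)
  Ushift-nonneg {y} y≥0 j j<d =
    NonnegV-resp (≋-sym (≋-trans (commuting-linear≋⊛ (Ushift-linear j) (Ushift-commutes-shift j) y)
                                 (lin-cong (⊛-linear y) (Ushift-e₀ j (ℕ.<⇒≤ j<d)))))
                 (∑V-nonneg d (λ i i<d → •-nonneg (y≥0 i i<d) (Ushift-e-nonneg i j i<d j<d)))

  ⊛-nonneg : ∀ {x y} → NonnegV x → NonnegV y → NonnegV (x ⊛ y)
  ⊛-nonneg x≥0 y≥0 = ∑V-nonneg d (λ j j<d → •-nonneg (x≥0 j j<d) (Ushift-nonneg y≥0 j j<d))

  _≋?_ : ∀ x y → Dec (x ≋ y)
  x ≋? y = map′ (λ p i → p {i}) (λ p {i} → p i) (ℕ.allUpTo? {P = λ i → x i ≈ y i} (λ i → x i ≟ y i) d)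

  coneRing : ConeRing
  coneRing = record
    { commutativeRing = commutativeRing′
    ; _≟_ = _≋?_
    ; Nonneg = NonnegV
    ; Nonneg-resp = NonnegV-resp
    ; 0-nonneg = 𝟘-nonneg
    ; 1-nonneg = e-nonneg 0
    ; +-nonneg = ⊕-nonneg
    ; *-nonneg = ⊛-nonneg
    ; nonneg-antisym = λ p q i h → nonneg-antisym (p i h) (q i h)
    ; 1≉0 = λ 1≋0 → 1≉0 (trans (sym (e-diag 0)) (1≋0 0 (s≤s z≤n)))
    }

  module K′ = ConeRing coneRing
  open Chebyshev commutativeRing using (U)
  open Chebyshev commutativeRing′ using () renaming (U to U′)

  ι : Carrier → V
  ι r = r • e 0

  ι-+ : ∀ r s → ι (r + s) ≋ ι r ⊕ ι s
  ι-+ r s i h = distribʳ _ _ _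

  ι-* : ∀ r s → ι (r * s) ≋ ι r ⊛ ι s
  ι-* r s = ≋-sym (≋-trans (lin-• (⊛-linear (ι r)) s (e 0))
                  (≋-trans (•-cong refl (⊛-identityʳ (ι r))) (λ i h → s[rx]≈[rs]x _ _ _)))
    where
    s[rx]≈[rs]x : ∀ s r x → s * (r * x) ≈ (r * s) * x
    s[rx]≈[rs]x = solve 3 (λ s r x → s :* (r :* x) := (r :* s) :* x) refl

  ι-U : ∀ a k → ι (U a k) ≋ U′ (ι a) k
  ι-U a zero i h = *-identityˡ _
  ι-U a (suc zero) = ≋-refl
  ι-U a (suc (suc k)) =
    ≋-trans (ι-+ _ _) (⊕-cong (≋-trans (ι-* _ _) (⊛-cong ≋-refl (ι-U a (suc k))))
                              (≋-trans (λ i h → sym (-‿distribˡ-* _ _)) (⊝-cong (ι-U a k))))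

  ι-IsTwoCosPiOver : ∀ {m a} → IsTwoCosPiOver A m a → IsTwoCosPiOver coneRing m (ι a)
  ι-IsTwoCosPiOver {m} {a} cos = record
    { U-root = ≋-trans (≋-sym (ι-U a (ℕ.pred m))) (λ i h → trans (*-congʳ (IsTwoCosPiOver.U-root cos)) (zeroˡ _))
    ; U-nonneg = λ j j<m-1 → NonnegV-resp (ι-U a j) (•-nonneg (IsTwoCosPiOver.U-nonneg cos j j<m-1) (e-nonneg 0))
    }

  c : V
  c = shift (e 0)

  U-c : ∀ k → U′ c k ≋ Ushift k (e 0)
  U-c zero = ≋-refl
  U-c (suc zero) = ≋-refl
  U-c (suc (suc k)) = ⊕-cong (≋-trans c⊛y≋shift-y (lin-cong shift-linear (U-c (suc k)))) (⊝-cong (U-c k))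
    where
    c⊛y≋shift-y : ∀ {y} → c ⊛ y ≋ shift y
    c⊛y≋shift-y {y} = ≋-trans (⊛-comm c y) (≋-sym (commuting-linear≋⊛ shift-linear (λ _ → ≋-refl) y))

  c-isTwoCosPiOver : IsTwoCosPiOver coneRing (suc d) c
  c-isTwoCosPiOver = record
    { U-root = ≋-trans (U-c d) (≋-trans (Ushift-e₀ d ℕ.≤-refl) e-d≋𝟘)
    ; U-nonneg = λ j j<d → NonnegV-resp (≋-sym (≋-trans (U-c j) (Ushift-e₀ j (ℕ.<⇒≤ j<d)))) (e-nonneg j)
    }

ℤ-coneRing : ConeRing
ℤ-coneRing = record
  { commutativeRing = ℤ.+-*-commutativeRing
  ; _≟_ = ℤ._≟_
  ; Nonneg = 0ℤ ℤ.≤_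
  ; Nonneg-resp = λ { ≡.refl p → p }
  ; 0-nonneg = ℤ.≤-refl
  ; 1-nonneg = +≤+ z≤n
  ; +-nonneg = ℤ.+-mono-≤
  ; *-nonneg = *-nonneg
  ; nonneg-antisym = antisym
  ; 1≉0 = λ ()
  }
  where
  *-nonneg : ∀ {i j} → 0ℤ ℤ.≤ i → 0ℤ ℤ.≤ j → 0ℤ ℤ.≤ i ℤ.* j
  *-nonneg {+ m} {+ n} _ _ = ≡.subst (0ℤ ℤ.≤_) (ℤ.pos-* m n) (+≤+ z≤n)
  antisym : ∀ {i} → 0ℤ ℤ.≤ i → 0ℤ ℤ.≤ ℤ.- i → i ≡ 0ℤ
  antisym {+ zero} _ _ = ≡.refl
  antisym {+ suc n} _ ()

-- Level N adjoins to level N - 1 the element 2cos(π/(N + 1)), as the root c of U_N.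
tower : ℕ → ConeRing
tower zero = ℤ-coneRing
tower (suc N) = ChebyshevExtension.coneRing (tower N) N

-- Only the values at 2 ≤ m ≤ N + 1 are meaningful.
towerTwoCos : ∀ N → ℕ → ConeRing.Carrier (tower N)
towerTwoCos zero m = 0ℤ
towerTwoCos (suc N) m with m ℕ.≟ suc (suc N)
... | yes _ = ChebyshevExtension.c (tower N) N
... | no _ = ChebyshevExtension.ι (tower N) N (towerTwoCos N m)

towerTwoCos-isTwoCosPiOver : ∀ N m → 2 ≤ m → m ≤ suc N → IsTwoCosPiOver (tower N) m (towerTwoCos N m)
towerTwoCos-isTwoCosPiOver zero m 2≤m m≤1 = ⊥-elim (ℕ.<-irrefl ≡.refl (ℕ.≤-trans 2≤m m≤1))
towerTwoCos-isTwoCosPiOver (suc N) m 2≤m m≤N+2 with m ℕ.≟ suc (suc N)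
... | yes ≡.refl = ChebyshevExtension.c-isTwoCosPiOver (tower N) N
... | no m≢N+2 = ChebyshevExtension.ι-IsTwoCosPiOver (tower N) N
                   (towerTwoCos-isTwoCosPiOver N m 2≤m (ℕ.≤-pred (ℕ.≤∧≢⇒< m≤N+2 m≢N+2)))

module CoxeterWords {n : ℕ} (M : CoxeterMatrix n) where
  open CoxeterMatrix M

  infix 4 _≃_
  _≃_ : Word n → Word n → Set
  u ≃ v = M ⊢ u ≈ v

  ≃-reflexive : ∀ {u v} → u ≡ v → u ≃ v
  ≃-reflexive ≡.refl = ≈refl

  ≃-context : ∀ a b {u v} → u ≃ v → a ++ (u ++ b) ≃ a ++ (v ++ b)
  ≃-context a b (rel p q s t) = ≡.subst₂ _≃_ (≡.sym lhs) (≡.sym (reassoc q)) (rel (a ++ p) (q ++ b) s t)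
    where
    reassoc : ∀ r → a ++ ((p ++ r) ++ b) ≡ (a ++ p) ++ (r ++ b)
    reassoc r = ≡.trans (≡.cong (a ++_) (++-assoc p r b)) (≡.sym (++-assoc a p _))
    lhs : a ++ ((p ++ (relator M s t ++ q)) ++ b) ≡ (a ++ p) ++ (relator M s t ++ (q ++ b))
    lhs = ≡.trans (reassoc (relator M s t ++ q)) (≡.cong ((a ++ p) ++_) (++-assoc (relator M s t) q b))
  ≃-context a b ≈refl = ≈refl
  ≃-context a b (≈sym p) = ≈sym (≃-context a b p)
  ≃-context a b (≈trans p q) = ≈trans (≃-context a b p) (≃-context a b q)

  ++-congˡ : ∀ a {u v} → u ≃ v → a ++ u ≃ a ++ v
  ++-congˡ a {u} {v} p =
    ≡.subst₂ _≃_ (≡.cong (a ++_) (++-identityʳ u)) (≡.cong (a ++_) (++-identityʳ v)) (≃-context a [] p)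

  ++-congʳ : ∀ b {u v} → u ≃ v → u ++ b ≃ v ++ b
  ++-congʳ b p = ≃-context [] b p

  ++-cong : ∀ {u u′ v v′} → u ≃ u′ → v ≃ v′ → u ++ v ≃ u′ ++ v′
  ++-cong {u′ = u′} {v} p q = ≈trans (++-congʳ v p) (++-congˡ u′ q)

  ∷-cong : ∀ s {u v} → u ≃ v → s ∷ u ≃ s ∷ v
  ∷-cong s p = ++-congˡ [ s ] p

  relator-diag : ∀ s → relator M s s ≡ s ∷ s ∷ []
  relator-diag s = ≡.cong (λ k → alt s s (2 ℕ.* k)) (m-diag s)

  ss-cancel : ∀ a b s → a ++ (s ∷ s ∷ b) ≃ a ++ b
  ss-cancel a b s = ≡.subst (λ r → a ++ (r ++ b) ≃ a ++ b) (relator-diag s) (rel a b s s)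

  ss≃[] : ∀ s → s ∷ s ∷ [] ≃ []
  ss≃[] s = ss-cancel [] [] s

  ++-[s]-[s] : ∀ u s → (u ++ [ s ]) ++ [ s ] ≃ u
  ++-[s]-[s] u s = ≈trans (≃-reflexive (++-assoc u [ s ] [ s ])) (≈trans (ss-cancel u [] s) (≃-reflexive (++-identityʳ u)))

  ++-inverseʳ : ∀ u → u ++ reverse u ≃ []
  ++-inverseʳ [] = ≈refl
  ++-inverseʳ (s ∷ u) =
    ≈trans (≃-reflexive (≡.cong (s ∷_) (≡.trans (≡.cong (u ++_) (unfold-reverse s u)) (≡.sym (++-assoc u (reverse u) _)))))
           (≈trans (∷-cong s (++-congʳ [ s ] (++-inverseʳ u))) (ss≃[] s))

  ++-inverseˡ : ∀ u → reverse u ++ u ≃ []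
  ++-inverseˡ u = ≡.subst (λ v → reverse u ++ v ≃ []) (reverse-involutive u) (++-inverseʳ (reverse u))

  ++-cancelʳ : ∀ {u v} w → u ++ w ≃ v ++ w → u ≃ v
  ++-cancelʳ {u} {v} w p =
    ≈trans (≃-reflexive (≡.sym (++-identityʳ u)))
    (≈trans (++-congˡ u (≈sym (++-inverseʳ w)))
    (≈trans (≃-reflexive (≡.sym (++-assoc u w _)))
    (≈trans (++-congʳ (reverse w) p)
    (≈trans (≃-reflexive (++-assoc v w _))
    (≈trans (++-congˡ v (++-inverseʳ w)) (≃-reflexive (++-identityʳ v)))))))

  ++-cancelˡ : ∀ {u v} w → w ++ u ≃ w ++ v → u ≃ v
  ++-cancelˡ {u} {v} w p =
    ≈trans (++-congʳ u (≈sym (++-inverseˡ w)))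
    (≈trans (≃-reflexive (++-assoc (reverse w) w u))
    (≈trans (++-congˡ (reverse w) p)
    (≈trans (≃-reflexive (≡.sym (++-assoc (reverse w) w v)))
    (++-congʳ v (++-inverseˡ w)))))

  altLetter : Fin n → Fin n → ℕ → Fin n
  altLetter s t zero = s
  altLetter s t (suc k) = altLetter t s k

  alt-suc : ∀ (s t : Fin n) k → alt s t (suc k) ≡ alt s t k ++ [ altLetter s t k ]
  alt-suc s t zero = ≡.refl
  alt-suc s t (suc k) = ≡.cong (s ∷_) (alt-suc t s k)

  alt-double-suc : ∀ (s t : Fin n) k → alt s t (double (suc k)) ≡ alt s t (double k) ++ (s ∷ t ∷ [])
  alt-double-suc s t zero = ≡.refl
  alt-double-suc s t (suc k) = ≡.cong (λ w → s ∷ t ∷ w) (alt-double-suc s t k)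

  altLetter-double : ∀ s t k → altLetter s t (double k) ≡ s
  altLetter-double s t zero = ≡.refl
  altLetter-double s t (suc k) = altLetter-double s t k

  length-alt : ∀ (s t : Fin n) k → length (alt s t k) ≡ k
  length-alt s t zero = ≡.refl
  length-alt s t (suc k) = ≡.cong suc (length-alt t s k)

  alt-+ : ∀ (s t : Fin n) a b → alt s t (a ℕ.+ b) ≡ alt s t a ++ alt (altLetter s t a) (altLetter t s a) b
  alt-+ s t zero b = ≡.refl
  alt-+ s t (suc a) b = ≡.cong (s ∷_) (alt-+ t s a b)

  reverse-alt : ∀ (s t : Fin n) k → reverse (alt s t k) ≡ alt (altLetter t s k) (altLetter s t k) k
  reverse-alt s t zero = ≡.refl
  reverse-alt s t (suc k) =
    ≡.trans (≡.cong reverse (alt-suc s t k))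
    (≡.trans (reverse-++ (alt s t k) [ altLetter s t k ])
    (≡.cong (altLetter s t k ∷_) (reverse-alt s t k)))

  reverse-alt-double : ∀ (s t : Fin n) k → reverse (alt s t (double k)) ≡ alt t s (double k)
  reverse-alt-double s t k =
    ≡.trans (reverse-alt s t (double k)) (≡.cong₂ (λ a b → alt a b (double k)) (altLetter-double t s k) (altLetter-double s t k))

  relator≡alt : ∀ s t → relator M s t ≡ alt s t (double (m s t))
  relator≡alt s t = ≡.cong (alt s t) (≡.trans (≡.cong (m s t ℕ.+_) (ℕ.+-identityʳ (m s t))) (≡.sym (double≡+ (m s t))))

  reverse-relator : ∀ s t → reverse (relator M s t) ≡ relator M t s
  reverse-relator s t = begin
    reverse (relator M s t)            ≡⟨ ≡.cong reverse (relator≡alt s t) ⟩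
    reverse (alt s t (double (m s t))) ≡⟨ reverse-alt-double s t (m s t) ⟩
    alt t s (double (m s t))           ≡⟨ ≡.cong (alt t s ∘ double) (m-sym s t) ⟩
    alt t s (double (m t s))           ≡⟨ relator≡alt t s ⟨
    relator M t s                      ∎
    where open ≡.≡-Reasoning

  reverse-cong : ∀ {u v} → u ≃ v → reverse u ≃ reverse v
  reverse-cong (rel p q s t) = ≡.subst₂ _≃_ (≡.sym reverse-lhs) (≡.sym (reverse-++ p q)) (rel (reverse q) (reverse p) t s)
    where
    reverse-lhs : reverse (p ++ (relator M s t ++ q)) ≡ reverse q ++ (relator M t s ++ reverse p)
    reverse-lhs =
      ≡.trans (reverse-++ p _) (≡.trans (≡.cong (_++ reverse p) (reverse-++ (relator M s t) q))
      (≡.trans (++-assoc (reverse q) _ _) (≡.cong (λ r → reverse q ++ (r ++ reverse p)) (reverse-relator s t))))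
  reverse-cong ≈refl = ≈refl
  reverse-cong (≈sym p) = ≈sym (reverse-cong p)
  reverse-cong (≈trans p q) = ≈trans (reverse-cong p) (reverse-cong q)

  braid : ∀ s t → alt s t (m s t) ≃ alt t s (m s t)
  braid s t =
    ≈trans (≃-reflexive (≡.sym (++-identityʳ (alt s t k))))
    (≈trans (++-congˡ (alt s t k) (≈sym (++-inverseʳ rest)))
    (≈trans (≃-reflexive (≡.sym (++-assoc (alt s t k) rest (reverse rest))))
    (≈trans (++-congʳ (reverse rest) relator≃[])
    (≃-reflexive (≡.trans (reverse-alt (altLetter s t k) (altLetter t s k) k)
                          (≡.cong₂ (λ a b → alt a b k) (altLetter-altLetter s t k) (altLetter-altLetter t s k)))))))
    where
    k = m s t
    rest = alt (altLetter s t k) (altLetter t s k) k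
    altLetter-altLetter : ∀ (s t : Fin n) k → altLetter (altLetter t s k) (altLetter s t k) k ≡ t
    altLetter-altLetter s t zero = ≡.refl
    altLetter-altLetter s t (suc k) = altLetter-altLetter s t k
    relator≃[] : alt s t k ++ rest ≃ []
    relator≃[] = ≈trans (≃-reflexive (≡.sym (≡.trans (relator≡alt s t) (≡.trans (≡.cong (alt s t) (double≡+ k)) (alt-+ s t k k)))))
                        (≡.subst (_≃ []) (++-identityʳ (relator M s t)) (rel [] [] s t))

  altLetter-suc-swap : ∀ (s t : Fin n) k → (altLetter s t k ≡ s × altLetter s t (suc k) ≡ t) ⊎ (altLetter s t k ≡ t × altLetter s t (suc k) ≡ s)
  altLetter-suc-swap s t zero = inj₁ (≡.refl , ≡.refl)
  altLetter-suc-swap s t (suc k) with altLetter-suc-swap t s k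
  ... | inj₁ (p , q) = inj₂ (p , q)
  ... | inj₂ (p , q) = inj₁ (p , q)

  move-letterʳ : ∀ {u v} s → u ++ [ s ] ≃ v → u ≃ v ++ [ s ]
  move-letterʳ {u} s p = ≈trans (≈sym (++-[s]-[s] u s)) (++-congʳ [ s ] p)

  length-++-alt : ∀ w (s t : Fin n) k → length (w ++ alt s t k) ≡ length w ℕ.+ k
  length-++-alt w s t k = ≡.trans (length-++ w) (≡.cong (length w ℕ.+_) (length-alt s t k))

  parity-double : ∀ k → parity (double k) ≡ 0ℙ
  parity-double zero = ≡.refl
  parity-double (suc k) = parity-double k

  parity-length-cong : ∀ {u v} → u ≃ v → parity (length u) ≡ parity (length v)
  parity-length-cong (rel p q s t) = begin
    parity (length (p ++ (relator M s t ++ q)))                             ≡⟨ ≡.cong parity length-lhs ⟩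
    parity (length p ℕ.+ (double (m s t) ℕ.+ length q))                     ≡⟨ ℙ.+-homo-+ (length p) _ ⟩
    parity (length p) ℙ.+ parity (double (m s t) ℕ.+ length q)             ≡⟨ ≡.cong (parity (length p) ℙ.+_) (ℙ.+-homo-+ (double (m s t)) _) ⟩
    parity (length p) ℙ.+ (parity (double (m s t)) ℙ.+ parity (length q))  ≡⟨ ≡.cong (λ π → parity (length p) ℙ.+ (π ℙ.+ _)) (parity-double (m s t)) ⟩
    parity (length p) ℙ.+ parity (length q)                                 ≡⟨ ℙ.+-homo-+ (length p) _ ⟨
    parity (length p ℕ.+ length q)                                          ≡⟨ ≡.cong parity (length-++ p) ⟨
    parity (length (p ++ q))                                                ∎
    where
    open ≡.≡-Reasoning
    length-lhs : length (p ++ (relator M s t ++ q)) ≡ length p ℕ.+ (double (m s t) ℕ.+ length q)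
    length-lhs = ≡.trans (length-++ p) (≡.cong (length p ℕ.+_) (≡.trans (length-++ (relator M s t))
                   (≡.cong (ℕ._+ length q) (≡.trans (≡.cong length (relator≡alt s t)) (length-alt s t _)))))
  parity-length-cong ≈refl = ≡.refl
  parity-length-cong (≈sym p) = ≡.sym (parity-length-cong p)
  parity-length-cong (≈trans p q) = ≡.trans (parity-length-cong p) (parity-length-cong q)

  IsLength-unique : ∀ {w k k′} → IsLength M w k → IsLength M w k′ → k ≡ k′
  IsLength-unique ((u , u≃w , u≡k) , k-min) ((u′ , u′≃w , u′≡k′) , k′-min) =
    ℕ.≤-antisym (ℕ.≤-trans (k-min u′ u′≃w) (ℕ.≤-reflexive u′≡k′)) (ℕ.≤-trans (k′-min u u≃w) (ℕ.≤-reflexive u≡k))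

module LengthFunction {n : ℕ} (M : CoxeterMatrix n) (ℓ-isLength : ∀ w → Σ ℕ (IsLength M w)) where
  open CoxeterWords M

  ℓ : Word n → ℕ
  ℓ w = proj₁ (ℓ-isLength w)

  reduced : Word n → Word n
  reduced w = proj₁ (proj₁ (proj₂ (ℓ-isLength w)))

  reduced≃ : ∀ w → reduced w ≃ w
  reduced≃ w = proj₁ (proj₂ (proj₁ (proj₂ (ℓ-isLength w))))

  length-reduced : ∀ w → length (reduced w) ≡ ℓ w
  length-reduced w = proj₂ (proj₂ (proj₁ (proj₂ (ℓ-isLength w))))

  ℓ-minimal : ∀ {u} w → u ≃ w → ℓ w ≤ length u
  ℓ-minimal {u} w u≃w = proj₂ (proj₂ (ℓ-isLength w)) u u≃w

  ℓ-≤ : ∀ {u w} → u ≃ w → ℓ w ≤ ℓ u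
  ℓ-≤ {u} {w} u≃w = ℕ.≤-trans (ℓ-minimal w (≈trans (reduced≃ u) u≃w)) (ℕ.≤-reflexive (length-reduced u))

  ℓ-cong : ∀ {u w} → u ≃ w → ℓ u ≡ ℓ w
  ℓ-cong u≃w = ℕ.≤-antisym (ℓ-≤ (≈sym u≃w)) (ℓ-≤ u≃w)

  parity-ℓ : ∀ w → parity (ℓ w) ≡ parity (length w)
  parity-ℓ w = ≡.trans (≡.cong parity (≡.sym (length-reduced w))) (parity-length-cong (reduced≃ w))

  ℓ-∷ʳ-≤ : ∀ u s → ℓ (u ++ [ s ]) ≤ suc (ℓ u)
  ℓ-∷ʳ-≤ u s = ℕ.≤-trans (ℓ-minimal _ (++-congʳ [ s ] (reduced≃ u)))
                         (ℕ.≤-reflexive (≡.trans (length-++-alt (reduced u) s s 1) (≡.trans (ℕ.+-comm _ 1) (≡.cong suc (length-reduced u)))))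

  -- ℓ(us) ≠ ℓ(u) because the two lengths have different parities.
  ℓ-∷ʳ : ∀ u s → ℓ (u ++ [ s ]) ≡ suc (ℓ u) ⊎ suc (ℓ (u ++ [ s ])) ≡ ℓ u
  ℓ-∷ʳ u s with ℓ (u ++ [ s ]) ℕ.≟ suc (ℓ u)
  ... | yes ℓus≡ℓu+1 = inj₁ ℓus≡ℓu+1
  ... | no ℓus≢ℓu+1 = inj₂ (ℕ.≤-antisym (ℕ.≤∧≢⇒< (ℕ.≤-pred (ℕ.≤∧≢⇒< (ℓ-∷ʳ-≤ u s) ℓus≢ℓu+1)) ℓus≢ℓu)
                                      (ℕ.≤-trans (ℓ-≤ (++-[s]-[s] u s)) (ℓ-∷ʳ-≤ (u ++ [ s ]) s)))
    where
    ℓus≢ℓu : ℓ (u ++ [ s ]) ≢ ℓ u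
    ℓus≢ℓu ℓus≡ℓu = ℙ.p≢p⁻¹ (parity (ℓ u)) (begin
      parity (ℓ u)                        ≡⟨ ≡.cong parity ℓus≡ℓu ⟨
      parity (ℓ (u ++ [ s ]))             ≡⟨ parity-ℓ (u ++ [ s ]) ⟩
      parity (length (u ++ [ s ]))        ≡⟨ ≡.cong parity (≡.trans (length-++-alt u s s 1) (ℕ.+-comm _ 1)) ⟩
      parity (suc (length u))             ≡⟨ ℙ.⁻¹-selfInverse (ℙ.suc-homo-⁻¹ (length u)) ⟨
      parity (length u) ℙ.⁻¹              ≡⟨ ≡.cong ℙ._⁻¹ (parity-ℓ u) ⟨
      parity (ℓ u) ℙ.⁻¹                   ∎)
      where open ≡.≡-Reasoning

  ℓ-invariant : ∀ (f : Word n → Word n) → (∀ u → f (f u) ≃ u) → (∀ u → ℓ (f u) ≤ ℓ u) → ∀ u → ℓ (f u) ≡ ℓ u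
  ℓ-invariant f f∘f≃id ℓ∘f≤ℓ u = ℕ.≤-antisym (ℓ∘f≤ℓ u) (ℕ.≤-trans (ℕ.≤-reflexive (ℓ-cong (≈sym (f∘f≃id u)))) (ℓ∘f≤ℓ (f u)))

  ℓ-reverse : ∀ u → ℓ (reverse u) ≡ ℓ u
  ℓ-reverse = ℓ-invariant reverse (λ u → ≃-reflexive (reverse-involutive u)) ℓ-reverse-≤
    where
    ℓ-reverse-≤ : ∀ u → ℓ (reverse u) ≤ ℓ u
    ℓ-reverse-≤ u = ℕ.≤-trans (ℓ-minimal (reverse u) (reverse-cong (reduced≃ u)))
                              (ℕ.≤-reflexive (≡.trans (length-reverse (reduced u)) (length-reduced u)))

  ℓ-++-≤ : ∀ u v → ℓ (u ++ v) ≤ ℓ u ℕ.+ ℓ v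
  ℓ-++-≤ u v = ℕ.≤-trans (ℓ-minimal (u ++ v) (++-cong (reduced≃ u) (reduced≃ v)))
                         (ℕ.≤-reflexive (≡.trans (length-++ (reduced u)) (≡.cong₂ ℕ._+_ (length-reduced u) (length-reduced v))))

  ℓ-∷-≤ : ∀ s u → ℓ (s ∷ u) ≤ suc (ℓ u)
  ℓ-∷-≤ s u = ℕ.≤-trans (ℓ-++-≤ [ s ] u) (ℕ.+-monoˡ-≤ (ℓ u) (ℓ-minimal [ s ] ≈refl))

  ℓ-[] : ℓ [] ≡ 0
  ℓ-[] = ℕ.n≤0⇒n≡0 (ℓ-minimal [] ≈refl)

record CoxeterCosines {n : ℕ} (M : CoxeterMatrix n) (K : ConeRing) : Set where
  field
    twoCos : ℕ → ConeRing.Carrier K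
    twoCos-∞ : ConeRing._≈_ K (twoCos 0) (ConeRing._+_ K (ConeRing.1# K) (ConeRing.1# K))
    twoCos-1 : ConeRing._≈_ K (twoCos 1) (ConeRing.-_ K (ConeRing._+_ K (ConeRing.1# K) (ConeRing.1# K)))
    twoCos-m : ∀ s t → 2 ≤ CoxeterMatrix.m M s t →
               IsTwoCosPiOver K (CoxeterMatrix.m M s t) (twoCos (CoxeterMatrix.m M s t))

module GeometricRepresentation {n : ℕ} (M : CoxeterMatrix n) (K : ConeRing) (cos : CoxeterCosines M K) where
  open CoxeterMatrix M
  open ConeRing K hiding (zero)
  open CoxeterCosines cos
  open CoxeterWords M
  open Chebyshev commutativeRing using (U; Upred; U-suc; sumBelow; U-cassini; sum-U-even; sum-U-odd; sum-Upred-even)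
  open ℤ-CoefficientSolver commutativeRing using (solve; _:+_; _:*_; _:-_; :-_; _:=_)
  open import Algebra.Properties.Ring ring using (-‿involutive; -1*x≈-x; -‿distribˡ-*; -0#≈0#)
  open import Algebra.Properties.CommutativeMonoid.Sum +-commutativeMonoid using (sum; sum-cong-≋; ∑-distrib-+)
  open import Algebra.Properties.Semiring.Sum semiring using (*-distribˡ-sum)
  open import Data.Vec.Functional.Relation.Binary.Equality.Setoid setoid public
    using (_≋_; ≋-refl; ≋-sym; ≋-trans; ≋-reflexive)

  V : Set
  V = Fin n → Carrier

  infixl 6 _⊕_
  infixr 7 _•_

  _⊕_ : V → V → V
  (x ⊕ y) t = x t + y t

  ⊝ : V → V
  ⊝ x t = - x t

  𝟘 : V
  𝟘 t = 0#

  _•_ : Carrier → V → V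
  (r • x) t = r * x t

  ⊕-cong : ∀ {x x′ y y′} → x ≋ x′ → y ≋ y′ → x ⊕ y ≋ x′ ⊕ y′
  ⊕-cong p q t = +-cong (p t) (q t)

  ⊝-cong : ∀ {x x′} → x ≋ x′ → ⊝ x ≋ ⊝ x′
  ⊝-cong p t = -‿cong (p t)

  •-cong : ∀ {r r′ x x′} → r ≈ r′ → x ≋ x′ → r • x ≋ r′ • x′
  •-cong p q t = *-cong p (q t)

  e : ∀ {k} → Fin k → Fin k → Carrier
  e s t with s Fin.≟ t
  ... | yes _ = 1#
  ... | no _ = 0#

  e-diag : ∀ {k} (s : Fin k) → e s s ≈ 1#
  e-diag s with s Fin.≟ s
  ... | yes _ = refl
  ... | no s≢s = ⊥-elim (s≢s ≡.refl)

  e-offdiag : ∀ {k} {s t : Fin k} → s ≢ t → e s t ≈ 0#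
  e-offdiag {s = s} {t} s≢t with s Fin.≟ t
  ... | yes s≡t = ⊥-elim (s≢t s≡t)
  ... | no _ = refl

  e-suc : ∀ {k} (s t : Fin k) → e (Fin.suc s) (Fin.suc t) ≈ e s t
  e-suc s t with s Fin.≟ t | Fin.suc s Fin.≟ Fin.suc t
  ... | yes _ | yes _ = refl
  ... | no _ | no _ = refl
  ... | yes s≡t | no s≢t = ⊥-elim (s≢t (≡.cong Fin.suc s≡t))
  ... | no s≢t | yes s≡t = ⊥-elim (s≢t (Fin.suc-injective s≡t))

  sum-e : ∀ {k} (f : Fin k → Carrier) (s : Fin k) → sum (λ t → f t * e s t) ≈ f s
  sum-e {suc k} f Fin.zero =
    trans (+-cong (trans (*-congˡ (e-diag {suc k} Fin.zero)) (*-identityʳ _)) (sum-zeros (λ t → f (Fin.suc t)))) (+-identityʳ _)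
    where
    sum-zeros : ∀ {k} (g : Fin k → Carrier) → sum (λ t → g t * e {suc k} Fin.zero (Fin.suc t)) ≈ 0#
    sum-zeros {zero} g = refl
    sum-zeros {suc k} g = trans (+-cong (trans (*-congˡ (e-offdiag {suc (suc k)} {s = Fin.zero} {t = Fin.suc Fin.zero} (λ ()))) (zeroʳ _))
                                        (sum-zeros (λ t → g (Fin.suc t))))
                                (+-identityʳ 0#)
  sum-e {suc k} f (Fin.suc s) =
    trans (+-cong (trans (*-congˡ (e-offdiag {s = Fin.suc s} {t = Fin.zero} (λ ()))) (zeroʳ _))
                  (trans (sum-cong-≋ (λ t → *-congˡ (e-suc s t))) (sum-e (λ t → f (Fin.suc t)) s)))
          (+-identityˡ _)

  two : Carrier
  two = 1# + 1#

  two*x≈x+x : ∀ x → two * x ≈ x + x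
  two*x≈x+x x = trans (distribʳ x 1# 1#) (+-cong (*-identityˡ x) (*-identityˡ x))

  -- B s t = -2cos(π/m(s,t)), twice the usual bilinear form on the roots α_s; m(s,t) = 0 stands for ∞.
  B : Fin n → Fin n → Carrier
  B s t = - twoCos (m s t)

  B-diag : ∀ s → B s s ≈ two
  B-diag s = trans (-‿cong (trans (reflexive (≡.cong twoCos (m-diag s))) twoCos-1)) (-‿involutive two)

  pairing : Fin n → V → Carrier
  pairing s v = sum (λ t → B s t * v t)

  σ : Fin n → V → V
  σ s v t = v t + - (pairing s v * e s t)

  act : Word n → V → V
  act [] v = v
  act (s ∷ u) v = σ s (act u v)

  act-++ : ∀ u w x → act (u ++ w) x ≡ act u (act w x)
  act-++ [] w x = ≡.refl
  act-++ (s ∷ u) w x = ≡.cong (σ s) (act-++ u w x)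

  pairing-cong : ∀ s {x y} → x ≋ y → pairing s x ≈ pairing s y
  pairing-cong s p = sum-cong-≋ (λ t → *-congˡ (p t))

  pairing-⊕ : ∀ s x y → pairing s (x ⊕ y) ≈ pairing s x + pairing s y
  pairing-⊕ s x y = trans (sum-cong-≋ (λ t → distribˡ (B s t) (x t) (y t))) (∑-distrib-+ (λ t → B s t * x t) (λ t → B s t * y t))

  pairing-• : ∀ s r x → pairing s (r • x) ≈ r * pairing s x
  pairing-• s r x = trans (sum-cong-≋ (λ t → b[rx]≈r[bx] (B s t) r (x t))) (sym (*-distribˡ-sum r (λ t → B s t * x t)))
    where
    b[rx]≈r[bx] : ∀ b r x → b * (r * x) ≈ r * (b * x)
    b[rx]≈r[bx] = solve 3 (λ b r x → b :* (r :* x) := r :* (b :* x)) refl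

  pairing-e : ∀ s t → pairing s (e t) ≈ B s t
  pairing-e s t = sum-e (B s) t

  σ≋-pairing• : ∀ s v → σ s v ≋ v ⊕ (- pairing s v) • e s
  σ≋-pairing• s v t = +-congˡ (-‿distribˡ-* _ _)

  σ-cong : ∀ s {x y} → x ≋ y → σ s x ≋ σ s y
  σ-cong s p t = +-cong (p t) (-‿cong (*-congʳ (pairing-cong s p)))

  σ-⊕ : ∀ s x y → σ s (x ⊕ y) ≋ σ s x ⊕ σ s y
  σ-⊕ s x y t = trans (+-congˡ (-‿cong (*-congʳ (pairing-⊕ s x y)))) (regroup _ _ _ _ _)
    where
    regroup : ∀ x y a b w → (x + y) + - ((a + b) * w) ≈ (x + - (a * w)) + (y + - (b * w))
    regroup = solve 5 (λ x y a b w → (x :+ y) :- ((a :+ b) :* w) := (x :- (a :* w)) :+ (y :- (b :* w))) refl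

  σ-• : ∀ s r x → σ s (r • x) ≋ r • σ s x
  σ-• s r x t = trans (+-congˡ (-‿cong (*-congʳ (pairing-• s r x)))) (regroup _ _ _ _)
    where
    regroup : ∀ r x a w → r * x + - ((r * a) * w) ≈ r * (x + - (a * w))
    regroup = solve 4 (λ r x a w → r :* x :- ((r :* a) :* w) := r :* (x :- (a :* w))) refl

  σ-e-diag : ∀ s → σ s (e s) ≋ ⊝ (e s)
  σ-e-diag s t = trans (+-congˡ (-‿cong (trans (*-congʳ (trans (pairing-e s s) (B-diag s))) (two*x≈x+x _)))) (x-[x+x]≈-x _)
    where
    x-[x+x]≈-x : ∀ x → x + - (x + x) ≈ - x
    x-[x+x]≈-x = solve 1 (λ x → x :- (x :+ x) := :- x) refl

  σ-e-offdiag : ∀ s t → s ≢ t → σ s (e t) ≋ e t ⊕ twoCos (m s t) • e s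
  σ-e-offdiag s t _ u = +-congˡ (trans (-‿cong (*-congʳ (pairing-e s t))) (trans (-‿distribˡ-* _ _) (*-congʳ (-‿involutive _))))

  σ-involutive : ∀ s v → σ s (σ s v) ≋ v
  σ-involutive s v =
    ≋-trans (σ≋-pairing• s (σ s v)) (≋-trans (⊕-cong (σ≋-pairing• s v) (•-cong (-‿cong pairing-σ) ≋-refl)) (λ t → cancel _ _ _))
    where
    p = pairing s v
    pairing-σ : pairing s (σ s v) ≈ - p
    pairing-σ =
      trans (pairing-cong s (σ≋-pairing• s v))
      (trans (pairing-⊕ s v _)
      (trans (+-congˡ (trans (pairing-• s (- p) (e s)) (*-congˡ (trans (pairing-e s s) (B-diag s)))))
      (trans (+-congˡ (trans (*-comm _ _) (two*x≈x+x (- p)))) (x+[-x-x]≈-x p))))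
      where
      x+[-x-x]≈-x : ∀ x → x + (- x + - x) ≈ - x
      x+[-x-x]≈-x = solve 1 (λ x → x :+ (:- x :- x) := :- x) refl
    cancel : ∀ x a w → (x + - a * w) + - - a * w ≈ x
    cancel = solve 3 (λ x a w → (x :+ (:- a) :* w) :+ (:- (:- a)) :* w := x) refl

  act-cong : ∀ u {x y} → x ≋ y → act u x ≋ act u y
  act-cong [] p = p
  act-cong (s ∷ u) p = σ-cong s (act-cong u p)

  act-⊕ : ∀ u x y → act u (x ⊕ y) ≋ act u x ⊕ act u y
  act-⊕ [] x y = ≋-refl
  act-⊕ (s ∷ u) x y = ≋-trans (σ-cong s (act-⊕ u x y)) (σ-⊕ s _ _)

  act-• : ∀ u r x → act u (r • x) ≋ r • act u x
  act-• [] r x = ≋-refl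
  act-• (s ∷ u) r x = ≋-trans (σ-cong s (act-• u r x)) (σ-• s r _)

  act-⊝ : ∀ u x → act u (⊝ x) ≋ ⊝ (act u x)
  act-⊝ u x = ≋-trans (act-cong u ⊝≋-1•) (≋-trans (act-• u (- 1#) x) (≋-sym ⊝≋-1•))
    where
    ⊝≋-1• : ∀ {x} → ⊝ x ≋ (- 1#) • x
    ⊝≋-1• {x} t = sym (-1*x≈-x (x t))

  act-𝟘 : ∀ u → act u 𝟘 ≋ 𝟘
  act-𝟘 u = ≋-trans (act-cong u (λ t → sym (zeroˡ 0#))) (≋-trans (act-• u 0# 𝟘) (λ t → zeroˡ _))

  act-e-last : ∀ u s → act (u ++ [ s ]) (e s) ≋ ⊝ (act u (e s))
  act-e-last u s = ≡.subst (_≋ ⊝ (act u (e s))) (≡.sym (act-++ u [ s ] (e s)))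
                           (≋-trans (act-cong u (σ-e-diag s)) (act-⊝ u (e s)))

  κ : Fin n → Fin n → Carrier
  κ s t = twoCos (m s t)

  κ-sym : ∀ s t → κ s t ≡ κ t s
  κ-sym s t = ≡.cong twoCos (m-sym s t)

  act-alt-e : ∀ s t → s ≢ t → ∀ k → act (alt s t k) (e (altLetter s t k)) ≋ U (κ s t) k • e s ⊕ Upred (κ s t) k • e t
  act-alt-e s t s≢t zero u = sym (trans (+-cong (*-identityˡ _) (zeroˡ _)) (+-identityʳ _))
  act-alt-e s t s≢t (suc k) =
    ≋-trans (σ-cong s IH)
    (≋-trans (σ-⊕ s _ _)
    (≋-trans (⊕-cong (≋-trans (σ-• s _ _) (•-cong refl (σ-e-offdiag s t s≢t))) (≋-trans (σ-• s _ _) (•-cong refl (σ-e-diag s))))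
    (λ u → trans (regroup (U c k) (Upred c k) c (e s u) (e t u)) (+-congʳ (*-congʳ (sym (U-suc c k)))))))
    where
    c = κ s t
    IH : act (alt t s k) (e (altLetter t s k)) ≋ U c k • e t ⊕ Upred c k • e s
    IH = ≡.subst (λ c′ → act (alt t s k) (e (altLetter t s k)) ≋ U c′ k • e t ⊕ Upred c′ k • e s) (κ-sym t s)
                 (act-alt-e t s (λ t≡s → s≢t (≡.sym t≡s)) k)
    regroup : ∀ u w c x y → u * (y + c * x) + w * (- x) ≈ (c * u + - w) * x + u * y
    regroup = solve 5 (λ u w c x y → u :* (y :+ c :* x) :+ w :* (:- x) := (c :* u :- w) :* x :+ u :* y) refl

  act-alt-suc-e : ∀ s t k → act (alt s t (suc k)) (e (altLetter s t k)) ≋ ⊝ (act (alt s t k) (e (altLetter s t k)))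
  act-alt-suc-e s t k = ≡.subst (λ w → act w (e (altLetter s t k)) ≋ ⊝ (act (alt s t k) (e (altLetter s t k))))
                                (≡.sym (alt-suc s t k)) (act-e-last (alt s t k) (altLetter s t k))

  ∑V : ℕ → (ℕ → V) → V
  ∑V k F t = sumBelow k (λ i → F i t)

  -- With ρ = σ_s σ_t and ρ v = v + α e_s + β e_t, one gets ρ^k v = v + α X_k + β Y_k, where X_k and Y_k
  -- are the partial sums of ρ^i e_s and ρ^i e_t; both vanish at k = m(s, t) since U_{m-1}(κ) = 0.
  module DihedralRelator (s t : Fin n) (s≢t : s ≢ t) (m′ : ℕ) (m≡m′+2 : m s t ≡ suc (suc m′)) where
    c = κ s t

    U-c-root : U c (suc m′) ≈ 0#
    U-c-root = ≡.subst (λ k → U c (ℕ.pred k) ≈ 0#) m≡m′+2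
                       (IsTwoCosPiOver.U-root (twoCos-m s t (≡.subst (2 ≤_) (≡.sym m≡m′+2) (s≤s (s≤s z≤n)))))

    ρ^ : ℕ → V → V
    ρ^ k v = act (alt s t (double k)) v

    ρ^-suc : ∀ k v → ρ^ (suc k) v ≡ ρ^ k (σ s (σ t v))
    ρ^-suc k v = ≡.trans (≡.cong (λ w → act w v) (alt-double-suc s t k)) (act-++ (alt s t (double k)) (s ∷ t ∷ []) v)

    ρ^-e-s : ∀ i → ρ^ i (e s) ≋ U c (double i) • e s ⊕ Upred c (double i) • e t
    ρ^-e-s i = ≡.subst (λ z → act (alt s t (double i)) (e z) ≋ U c (double i) • e s ⊕ Upred c (double i) • e t)
                       (altLetter-double s t i) (act-alt-e s t s≢t (double i))

    ρ^-e-t : ∀ i → ρ^ (suc i) (e t) ≋ ⊝ (U c (suc (double i)) • e s ⊕ U c (double i) • e t)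
    ρ^-e-t i = ≡.subst (λ z → act (alt s t (suc (suc (double i)))) (e z) ≋ ⊝ (U c (suc (double i)) • e s ⊕ U c (double i) • e t))
                       (altLetter-double t s i)
                       (≋-trans (act-alt-suc-e s t (suc (double i))) (⊝-cong (act-alt-e s t s≢t (suc (double i)))))

    X Y : ℕ → V
    X k = ∑V k (λ i → ρ^ i (e s))
    Y k = ∑V k (λ i → ρ^ i (e t))

    X≋ : ∀ k → X k ≋ sumBelow k (λ i → U c (double i)) • e s ⊕ sumBelow k (λ i → Upred c (double i)) • e t
    X≋ zero u = sym (trans (+-cong (zeroˡ _) (zeroˡ _)) (+-identityʳ 0#))
    X≋ (suc k) u = trans (+-cong (X≋ k u) (ρ^-e-s k u)) (regroup _ _ _ _ _ _)
      where
      regroup : ∀ a b a′ b′ x y → (a * x + b * y) + (a′ * x + b′ * y) ≈ (a + a′) * x + (b + b′) * y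
      regroup = solve 6 (λ a b a′ b′ x y → (a :* x :+ b :* y) :+ (a′ :* x :+ b′ :* y) := (a :+ a′) :* x :+ (b :+ b′) :* y) refl

    Y≋ : ∀ k → Y (suc k) ≋ e t ⊕ ⊝ (sumBelow k (λ i → U c (suc (double i))) • e s ⊕ sumBelow k (λ i → U c (double i)) • e t)
    Y≋ zero u = trans (+-identityˡ _) (sym (trans (+-congˡ (trans (-‿cong (trans (+-cong (zeroˡ _) (zeroˡ _)) (+-identityʳ 0#))) -0#≈0#))
                                                    (+-identityʳ _)))
    Y≋ (suc k) u = trans (+-cong (Y≋ k u) (ρ^-e-t k u)) (regroup _ _ _ _ _ _ _)
      where
      regroup : ∀ z a b a′ b′ x y → (z + - (a * x + b * y)) + - (a′ * x + b′ * y) ≈ z + - ((a + a′) * x + (b + b′) * y)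
      regroup = solve 7 (λ z a b a′ b′ x y → (z :- (a :* x :+ b :* y)) :- (a′ :* x :+ b′ :* y) := z :- ((a :+ a′) :* x :+ (b :+ b′) :* y)) refl

    X-m≋𝟘 : X (suc (suc m′)) ≋ 𝟘
    X-m≋𝟘 u = trans (X≋ (suc (suc m′)) u)
              (trans (+-cong (*-congʳ (trans (sum-U-even c (suc (suc m′))) (trans (*-congʳ U-c-root) (zeroˡ _))))
                             (*-congʳ (trans (sum-Upred-even c (suc m′)) (trans (*-congʳ U-c-root) (zeroˡ _)))))
                     (trans (+-cong (zeroˡ _) (zeroˡ _)) (+-identityʳ 0#)))

    U-m′² : U c m′ * U c m′ ≈ 1#
    U-m′² = trans (sym (trans (+-congˡ (trans (-‿cong (trans (*-congˡ U-c-root) (zeroʳ _))) -0#≈0#)) (+-identityʳ _)))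
                  (U-cassini c m′)

    Y-m≋𝟘 : Y (suc (suc m′)) ≋ 𝟘
    Y-m≋𝟘 u = trans (Y≋ (suc m′) u)
              (trans (+-congˡ (-‿cong (+-cong (*-congʳ (trans (sum-U-odd c (suc m′)) (trans (*-congʳ U-c-root) (zeroˡ _))))
                                              (*-congʳ (trans (sum-U-even c (suc m′)) U-m′²)))))
                     (y-[0x+1y]≈0 (e t u) (e s u)))
      where
      y-[0x+1y]≈0 : ∀ y x → y + - (0# * x + 1# * y) ≈ 0#
      y-[0x+1y]≈0 y x = trans (+-congˡ (-‿cong (trans (+-cong (zeroˡ x) (*-identityˡ y)) (+-identityˡ y)))) (-‿inverseʳ y)

    module _ (v : V) where
      α β : Carrier
      α = - pairing s (σ t v)
      β = - pairing t v

      ρ≋ : σ s (σ t v) ≋ v ⊕ (α • e s ⊕ β • e t)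
      ρ≋ = ≋-trans (σ≋-pairing• s (σ t v)) (≋-trans (⊕-cong (σ≋-pairing• t v) ≋-refl) (λ u → regroup _ _ _ _ _))
        where
        regroup : ∀ v a b x y → (v + b * y) + a * x ≈ v + (a * x + b * y)
        regroup = solve 5 (λ v a b x y → (v :+ b :* y) :+ a :* x := v :+ (a :* x :+ b :* y)) refl

      ρ^≋ : ∀ k → ρ^ k v ≋ v ⊕ (α • X k ⊕ β • Y k)
      ρ^≋ zero u = sym (trans (+-congˡ (trans (+-cong (zeroʳ _) (zeroʳ _)) (+-identityʳ 0#))) (+-identityʳ _))
      ρ^≋ (suc k) =
        ≋-trans (≋-reflexive (ρ^-suc k v))
        (≋-trans (act-cong w ρ≋)
        (≋-trans (act-⊕ w v _)
        (≋-trans (⊕-cong (ρ^≋ k) (≋-trans (act-⊕ w _ _) (⊕-cong (act-• w α (e s)) (act-• w β (e t)))))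
        (λ u → regroup _ _ _ _ _ _ _))))
        where
        w = alt s t (double k)
        regroup : ∀ v a b X Y x y → (v + (a * X + b * Y)) + (a * x + b * y) ≈ v + (a * (X + x) + b * (Y + y))
        regroup = solve 7 (λ v a b X Y x y → (v :+ (a :* X :+ b :* Y)) :+ (a :* x :+ b :* y) := v :+ (a :* (X :+ x) :+ b :* (Y :+ y))) refl

      ρ^m≋id : ρ^ (suc (suc m′)) v ≋ v
      ρ^m≋id = ≋-trans (ρ^≋ (suc (suc m′)))
                       (λ u → trans (+-congˡ (trans (+-cong (trans (*-congˡ (X-m≋𝟘 u)) (zeroʳ _)) (trans (*-congˡ (Y-m≋𝟘 u)) (zeroʳ _)))
                                                   (+-identityʳ 0#)))
                                    (+-identityʳ _))

  act-relator : ∀ s t v → act (relator M s t) v ≋ v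
  act-relator s t v with s Fin.≟ t
  ... | yes ≡.refl = ≡.subst (λ w → act w v ≋ v) (≡.sym (relator-diag s)) (σ-involutive s v)
  ... | no s≢t with m-off s t s≢t
  ...   | inj₁ m≡0 = ≡.subst (λ w → act w v ≋ v) (≡.sym (≡.trans (relator≡alt s t) (≡.cong (alt s t ∘ double) m≡0))) ≋-refl
  ...   | inj₂ 2≤m with ℕ.m≤n⇒∃[o]m+o≡n 2≤m
  ...     | m′ , m′+2≡m = ≡.subst (λ w → act w v ≋ v) (≡.sym (≡.trans (relator≡alt s t) (≡.cong (alt s t ∘ double) (≡.sym m′+2≡m))))
                                (DihedralRelator.ρ^m≋id s t s≢t m′ (≡.sym m′+2≡m) v)

  act-resp : ∀ {u w} → u ≃ w → ∀ x → act u x ≋ act w x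
  act-resp (rel p q s t) x =
    ≡.subst₂ _≋_ (≡.sym (≡.trans (act-++ p _ x) (≡.cong (act p) (act-++ (relator M s t) q x)))) (≡.sym (act-++ p q x))
      (act-cong p (act-relator s t (act q x)))
  act-resp ≈refl x = ≋-refl
  act-resp (≈sym p) x = ≋-sym (act-resp p x)
  act-resp (≈trans p q) x = ≋-trans (act-resp p x) (act-resp q x)

  act-reverse-act : ∀ u x → act (reverse u) (act u x) ≋ x
  act-reverse-act u x = ≡.subst (_≋ x) (act-++ (reverse u) u x) (act-resp (++-inverseˡ u) x)

module RootPositivity {n : ℕ} (M : CoxeterMatrix n) (K : ConeRing) (cos : CoxeterCosines M K) where
  open CoxeterMatrix M
  open ConeRing K hiding (zero)
  open CoxeterCosines cos
  open CoxeterWords M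
  open GeometricRepresentation M K cos
  open Chebyshev commutativeRing using (U; Upred)
  open ChebyshevNonneg K

  NonnegV : V → Set
  NonnegV x = ∀ t → Nonneg (x t)

  NonposV : V → Set
  NonposV x = ∀ t → Nonneg (- x t)

  NonnegV-resp : ∀ {x y} → x ≋ y → NonnegV x → NonnegV y
  NonnegV-resp p q t = Nonneg-resp (p t) (q t)

  NonposV-resp : ∀ {x y} → x ≋ y → NonposV x → NonposV y
  NonposV-resp p q t = Nonneg-resp (-‿cong (p t)) (q t)

  e-nonneg : ∀ s → NonnegV (e s)
  e-nonneg s t with s Fin.≟ t
  ... | yes _ = 1-nonneg
  ... | no _ = 0-nonneg

  κ-coefficients-nonneg : ∀ s t → s ≢ t → ∀ {k} → m s t ≡ 0 ⊎ k < m s t → Nonneg (U (κ s t) k) × Nonneg (Upred (κ s t) k)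
  κ-coefficients-nonneg s t s≢t {k} (inj₁ m≡0) = U-nonneg-at-two (trans (reflexive (≡.cong twoCos m≡0)) twoCos-∞) k
  κ-coefficients-nonneg s t s≢t {k} (inj₂ k<m) with m-off s t s≢t
  ... | inj₁ m≡0 = U-nonneg-at-two (trans (reflexive (≡.cong twoCos m≡0)) twoCos-∞) k
  ... | inj₂ 2≤m = U-nonneg-below (twoCos-m s t 2≤m) k<m

  act-alt-nonneg : ∀ v x y {k} → x ≢ y → m x y ≡ 0 ⊎ k < m x y → NonnegV (act v (e x)) → NonnegV (act v (e y)) →
                   NonnegV (act (v ++ alt x y k) (e (altLetter x y k)))
  act-alt-nonneg v x y {k} x≢y k<m vx≥0 vy≥0 =
    NonnegV-resp (≋-sym act-v-alt) (λ t → +-nonneg (*-nonneg Uk≥0 (vx≥0 t)) (*-nonneg Upredk≥0 (vy≥0 t)))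
    where
    Uk≥0 = proj₁ (κ-coefficients-nonneg x y x≢y k<m)
    Upredk≥0 = proj₂ (κ-coefficients-nonneg x y x≢y k<m)
    act-v-alt : act (v ++ alt x y k) (e (altLetter x y k)) ≋ U (κ x y) k • act v (e x) ⊕ Upred (κ x y) k • act v (e y)
    act-v-alt = ≡.subst (_≋ U (κ x y) k • act v (e x) ⊕ Upred (κ x y) k • act v (e y)) (≡.sym (act-++ v (alt x y k) _))
                        (≋-trans (act-cong v (act-alt-e x y x≢y k))
                                 (≋-trans (act-⊕ v _ _) (⊕-cong (act-• v _ _) (act-• v _ _))))

  ShortensBy : Word n → Fin n → Set
  ShortensBy u s = Σ (Word n) λ w → (w ≃ u ++ [ s ]) × (length w < length u)

  NonnegOrShortens : Word n → Fin n → Set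
  NonnegOrShortens u s = NonnegV (act u (e s)) ⊎ ShortensBy u s

  -- u = v · alt x y (k + 1), an alternating word in r and s ending in r and continued by s.
  record AlternatingTail (u : Word n) (s r : Fin n) : Set where
    field
      v : Word n
      x y : Fin n
      k : ℕ
      x≢y : x ≢ y
      last≡r : altLetter x y k ≡ r
      next≡s : altLetter x y (suc k) ≡ s
      u≃v·alt : u ≃ v ++ alt x y (suc k)
      length-v+k<u : length v ℕ.+ suc k ≤ length u
      k+1<m : m x y ≡ 0 ⊎ suc k < m x y

  module AlternatingTailLemmas {u : Word n} {s r : Fin n} (tail : AlternatingTail u s r) where
    open AlternatingTail tail public

    v<u : length v < length u
    v<u = ℕ.<-≤-trans (ℕ.m<m+n (length v) (s≤s z≤n)) length-v+k<u

    xy≡rs⊎sr : (x ≡ r × y ≡ s) ⊎ (x ≡ s × y ≡ r)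
    xy≡rs⊎sr with altLetter-suc-swap x y k
    ... | inj₁ (p , q) = inj₁ (≡.trans (≡.sym p) last≡r , ≡.trans (≡.sym q) next≡s)
    ... | inj₂ (p , q) = inj₂ (≡.trans (≡.sym q) next≡s , ≡.trans (≡.sym p) last≡r)

    s∈xy : s ≡ x ⊎ s ≡ y
    s∈xy with xy≡rs⊎sr
    ... | inj₁ (_ , y≡s) = inj₂ (≡.sym y≡s)
    ... | inj₂ (x≡s , _) = inj₁ (≡.sym x≡s)

    r∈xy : r ≡ x ⊎ r ≡ y
    r∈xy with xy≡rs⊎sr
    ... | inj₁ (x≡r , _) = inj₁ (≡.sym x≡r)
    ... | inj₂ (_ , y≡r) = inj₂ (≡.sym y≡r)

    x∈sr : x ≡ s ⊎ x ≡ r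
    x∈sr = ⊎.map proj₁ proj₁ (⊎.swap xy≡rs⊎sr)

    y∈sr : y ≡ s ⊎ y ≡ r
    y∈sr = ⊎.map proj₂ proj₂ xy≡rs⊎sr

    root-nonneg : NonnegV (act v (e s)) → NonnegV (act v (e r)) → NonnegV (act u (e s))
    root-nonneg vs≥0 vr≥0 =
      NonnegV-resp (act-resp (≈sym u≃v·alt) (e s))
                   (≡.subst (λ z → NonnegV (act (v ++ alt x y (suc k)) (e z))) next≡s
                            (act-alt-nonneg v x y x≢y k+1<m (nonneg-at x∈sr) (nonneg-at y∈sr)))
      where
      nonneg-at : ∀ {z} → z ≡ s ⊎ z ≡ r → NonnegV (act v (e z))
      nonneg-at (inj₁ ≡.refl) = vs≥0
      nonneg-at (inj₂ ≡.refl) = vr≥0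

    cancel-first : ShortensBy v x → Σ (Word n) λ w → (w ≃ u) × (length w < length u)
    cancel-first (w , w≃vx , w<v) = w ++ alt y x k , ≈sym u≃w·alt , ≡.subst (_< length u) (≡.sym (length-++-alt w y x k)) w+k<u
      where
      u≃w·alt : u ≃ w ++ alt y x k
      u≃w·alt = ≈trans u≃v·alt (≈trans (++-congʳ (alt x y (suc k)) (move-letterʳ x (≈sym w≃vx)))
                                       (≈trans (≃-reflexive (++-assoc w [ x ] (alt x y (suc k)))) (ss-cancel w (alt y x k) x)))
      w+k<u : length w ℕ.+ k < length u
      w+k<u = ℕ.≤-trans (ℕ.≤-reflexive (≡.sym (ℕ.+-suc (length w) k))) (ℕ.≤-trans (ℕ.+-monoˡ-≤ (suc k) (ℕ.<⇒≤ w<v)) length-v+k<u)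

    u≃w·y·alt : ∀ {w} → w ≃ v ++ [ y ] → u ≃ w ++ alt y x (suc (suc k))
    u≃w·y·alt {w} w≃vy = ≈trans u≃v·alt (≈trans (++-congʳ (alt x y (suc k)) (move-letterʳ y (≈sym w≃vy)))
                                                (≃-reflexive (++-assoc w [ y ] (alt x y (suc k)))))

    k+2<m⊎k+2≡m : (m x y ≡ 0 ⊎ suc (suc k) < m x y) ⊎ (suc (suc k) ≡ m x y)
    k+2<m⊎k+2≡m with k+1<m
    ... | inj₁ m≡0 = inj₁ (inj₁ m≡0)
    ... | inj₂ k+1<m′ with suc (suc k) ℕ.<? m x y
    ...   | yes k+2<m = inj₁ (inj₂ k+2<m)
    ...   | no k+2≮m = inj₂ (ℕ.≤-antisym k+1<m′ (ℕ.≮⇒≥ k+2≮m))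

    extend : ShortensBy v y → m x y ≡ 0 ⊎ suc (suc k) < m x y → AlternatingTail u s r
    extend (w , w≃vy , w<v) k+2<m = record
      { v = w ; x = y ; y = x ; k = suc k
      ; x≢y = λ y≡x → x≢y (≡.sym y≡x)
      ; last≡r = last≡r
      ; next≡s = next≡s
      ; u≃v·alt = u≃w·y·alt w≃vy
      ; length-v+k<u = ℕ.≤-trans (ℕ.≤-reflexive (ℕ.+-suc (length w) (suc k))) (ℕ.≤-trans (ℕ.+-monoˡ-≤ (suc k) w<v) length-v+k<u)
      ; k+1<m = ⊎.map (≡.trans (m-sym y x)) (≡.subst (suc (suc k) <_) (m-sym x y)) k+2<m
      }

    braid-exit : ShortensBy v y → suc (suc k) ≡ m x y → ShortensBy u s
    braid-exit (w , w≃vy , w<v) k+2≡m =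
      w ++ alt x y (suc k) , ≈sym u·s≃w·alt , ≡.subst (_< length u) (≡.sym (length-++-alt w x y (suc k))) w+k+1<u
      where
      alt-yx≃alt-xy·s : alt y x (suc (suc k)) ≃ alt x y (suc k) ++ [ s ]
      alt-yx≃alt-xy·s = ≈trans (≡.subst (λ j → alt y x j ≃ alt x y j) (≡.trans (m-sym y x) (≡.sym k+2≡m)) (braid y x))
                               (≃-reflexive (≡.trans (alt-suc x y (suc k)) (≡.cong (λ z → alt x y (suc k) ++ [ z ]) next≡s)))
      u·s≃w·alt : u ++ [ s ] ≃ w ++ alt x y (suc k)
      u·s≃w·alt = ≈trans (++-congʳ [ s ] (≈trans (u≃w·y·alt w≃vy) (++-congˡ w alt-yx≃alt-xy·s)))
                  (≈trans (≃-reflexive (≡.cong (_++ [ s ]) (≡.sym (++-assoc w (alt x y (suc k)) [ s ]))))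
                          (++-[s]-[s] (w ++ alt x y (suc k)) s))
      w+k+1<u : length w ℕ.+ suc k < length u
      w+k+1<u = ℕ.<-≤-trans (ℕ.+-monoˡ-< (suc k) w<v) length-v+k<u

  module Descent (N : ℕ) (IH : ∀ w s → length w ≤ N → NonnegOrShortens w s)
                 {u : Word n} {s r : Fin n} (u≤N+1 : length u ≤ suc N) where

    from-shorter : (Σ (Word n) λ w → (w ≃ u) × (length w < length u)) → NonnegOrShortens u s
    from-shorter (w , w≃u , w<u) = transfer (IH w s (ℕ.≤-pred (ℕ.≤-trans w<u u≤N+1)))
      where
      transfer : NonnegOrShortens w s → NonnegOrShortens u s
      transfer (inj₁ ws≥0) = inj₁ (NonnegV-resp (act-resp w≃u (e s)) ws≥0)
      transfer (inj₂ (w′ , w′≃ws , w′<w)) = inj₂ (w′ , ≈trans w′≃ws (++-congʳ [ s ] w≃u) , ℕ.<-trans w′<w w<u)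

    descend : ∀ F (tail : AlternatingTail u s r) → length (AlternatingTail.v tail) ≤ F → NonnegOrShortens u s
    descend< : ∀ F (tail : AlternatingTail u s r) → length (AlternatingTail.v tail) < F → NonnegOrShortens u s
    descend< (suc F) tail v<F+1 = descend F tail (ℕ.≤-pred v<F+1)

    descend F tail v≤F = combine (IH v s v≤N) (IH v r v≤N)
      where
      open AlternatingTailLemmas tail
      v≤N : length v ≤ N
      v≤N = ℕ.≤-pred (ℕ.≤-trans v<u u≤N+1)
      shortened : ∀ {z} → z ≡ x ⊎ z ≡ y → ShortensBy v z → NonnegOrShortens u s
      shortened (inj₁ ≡.refl) v·x-shorter = from-shorter (cancel-first v·x-shorter)
      shortened (inj₂ ≡.refl) v·y-shorter with k+2<m⊎k+2≡m
      ... | inj₁ k+2<m = descend< F (extend v·y-shorter k+2<m) (ℕ.<-≤-trans (proj₂ (proj₂ v·y-shorter)) v≤F)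
      ... | inj₂ k+2≡m = inj₂ (braid-exit v·y-shorter k+2≡m)
      combine : NonnegOrShortens v s → NonnegOrShortens v r → NonnegOrShortens u s
      combine (inj₁ vs≥0) (inj₁ vr≥0) = inj₁ (root-nonneg vs≥0 vr≥0)
      combine (inj₂ v·s-shorter) _ = shortened s∈xy v·s-shorter
      combine (inj₁ _) (inj₂ v·r-shorter) = shortened r∈xy v·r-shorter

  nonneg-or-shortens-≤ : ∀ N u s → length u ≤ N → NonnegOrShortens u s
  nonneg-or-shortens-≤ zero [] s _ = inj₁ (e-nonneg s)
  nonneg-or-shortens-≤ (suc N) u s u≤N+1 with initLast u
  ... | [] = inj₁ (e-nonneg s)
  ... | u′ ∷ʳ′ r with r Fin.≟ s
  ...   | yes ≡.refl = inj₂ (u′ , ≈sym (++-[s]-[s] u′ r) , ℕ.≤-reflexive (≡.sym (≡.trans (length-++-alt u′ r r 1) (ℕ.+-comm (length u′) 1))))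
  ...   | no r≢s = Descent.descend N (nonneg-or-shortens-≤ N) u≤N+1 (length u′) tail ℕ.≤-refl
    where
    tail : AlternatingTail (u′ ∷ʳ r) s r
    tail = record
      { v = u′ ; x = r ; y = s ; k = 0 ; x≢y = r≢s
      ; last≡r = ≡.refl ; next≡s = ≡.refl ; u≃v·alt = ≈refl
      ; length-v+k<u = ℕ.≤-reflexive (≡.sym (length-++-alt u′ r s 1))
      ; k+1<m = m-off r s r≢s
      }

  nonneg-or-shortens : ∀ u s → NonnegOrShortens u s
  nonneg-or-shortens u s = nonneg-or-shortens-≤ (length u) u s ℕ.≤-refl

least-satisfying : ∀ {P : ℕ → Set} → Decidable P → ∀ {N} → P N → Σ ℕ λ k → P k × (∀ j → P j → k ≤ j)
least-satisfying {P} P? {N} pN = search 0 N ≡.refl (λ _ ())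
  where
  search : ∀ k d → k ℕ.+ d ≡ N → (∀ j → j < k → ¬ P j) → Σ ℕ λ k → P k × (∀ j → P j → k ≤ j)
  search k d k+d≡N below with P? k
  ... | yes pk = k , pk , λ j pj → ℕ.≮⇒≥ (λ j<k → below j j<k pj)
  search k zero k+0≡N below | no ¬pk = ⊥-elim (¬pk (≡.subst P (≡.trans (≡.sym k+0≡N) (ℕ.+-identityʳ k)) pN))
  search k (suc d) k+d+1≡N below | no ¬pk = search (suc k) d (≡.trans (≡.sym (ℕ.+-suc k d)) k+d+1≡N) below′
    where
    below′ : ∀ j → j < suc k → ¬ P j
    below′ j j<k+1 with j ℕ.≟ k
    ... | yes ≡.refl = ¬pk
    ... | no j≢k = below j (ℕ.≤∧≢⇒< (ℕ.≤-pred j<k+1) j≢k)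

any-list-of-length? : ∀ {n} k {P : List (Fin n) → Set} → Decidable P → Dec (∃ λ w → length w ≡ k × P w)
any-list-of-length? zero P? with P? []
... | yes p = yes ([] , ≡.refl , p)
... | no ¬p = no λ { ([] , _ , p) → ¬p p }
any-list-of-length? (suc k) P? with Fin.any? (λ s → any-list-of-length? k (λ w → P? (s ∷ w)))
... | yes (s , w , length≡k , p) = yes (s ∷ w , ≡.cong suc length≡k , p)
... | no ¬p = no λ { (s ∷ w , length≡k+1 , p) → ¬p (s , w , ℕ.suc-injective length≡k+1 , p) }

module WordProblem {n : ℕ} (M : CoxeterMatrix n) (K : ConeRing) (cos : CoxeterCosines M K) where
  open ConeRing K hiding (zero)
  open CoxeterWords M
  open GeometricRepresentation M K cos
  open RootPositivity M K cos
  open import Algebra.Properties.Ring ring using (-‿involutive)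

  FixesBasis : Word n → Set
  FixesBasis u = ∀ s → act u (e s) ≋ e s

  fixesBasis⇒≃[] : ∀ N u → length u ≤ N → FixesBasis u → u ≃ []
  fixesBasis⇒≃[] zero [] _ _ = ≈refl
  fixesBasis⇒≃[] (suc N) u u≤N+1 fixes with initLast u
  ... | [] = ≈refl
  ... | u′ ∷ʳ′ s = from (nonneg-or-shortens u′ s)
    where
    u′-e-s≋-e-s : act u′ (e s) ≋ ⊝ (e s)
    u′-e-s≋-e-s t = trans (sym (-‿involutive _)) (-‿cong (trans (sym (act-e-last u′ s t)) (fixes s t)))
    from : NonnegOrShortens u′ s → u′ ∷ʳ s ≃ []
    from (inj₁ u′-e-s≥0) = ⊥-elim (1≉0 (nonneg-antisym 1-nonneg (Nonneg-resp (trans (u′-e-s≋-e-s s) (-‿cong (e-diag s))) (u′-e-s≥0 s))))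
    from (inj₂ (w , w≃u , w<u′)) = ≈trans (≈sym w≃u) (fixesBasis⇒≃[] N w w≤N (λ t → ≋-trans (act-resp w≃u (e t)) (fixes t)))
      where
      w≤N : length w ≤ N
      w≤N = ℕ.≤-pred (ℕ.≤-trans (ℕ.<-trans w<u′ (ℕ.≤-reflexive (≡.sym (≡.trans (length-++ u′) (ℕ.+-comm (length u′) 1))))) u≤N+1)

  infix 4 _≃?_
  _≃?_ : ∀ u w → Dec (u ≃ w)
  u ≃? w with Fin.all? (λ s → Fin.all? (λ t → act (u ++ reverse w) (e s) t ≟ e s t))
  ... | yes fixes = yes (++-cancelʳ (reverse w) (≈trans (fixesBasis⇒≃[] _ _ ℕ.≤-refl fixes) (≈sym (++-inverseʳ w))))
  ... | no ¬fixes = no λ u≃w → ¬fixes λ s → act-resp (≈trans (++-congʳ (reverse w) u≃w) (++-inverseʳ w)) (e s)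

  ℓ-isLength : ∀ w → Σ ℕ (IsLength M w)
  ℓ-isLength w with least-satisfying (λ k → any-list-of-length? k (_≃? w)) (w , ≡.refl , ≈refl)
  ... | k , (u , length≡k , u≃w) , least = k , (u , u≃w , length≡k) , λ v v≃w → least (length v) (v , ≡.refl , v≃w)

  open LengthFunction M ℓ-isLength public

  ℓ-ascent⇒nonneg : ∀ u s → ℓ u < ℓ (u ++ [ s ]) → NonnegV (act u (e s))
  ℓ-ascent⇒nonneg u s ℓu<ℓus with nonneg-or-shortens (reduced u) s
  ... | inj₁ ≥0 = NonnegV-resp (act-resp (reduced≃ u) (e s)) ≥0
  ... | inj₂ (w , w≃us , w<u) =
    ⊥-elim (ℕ.<-irrefl ≡.refl (ℕ.<-≤-trans ℓu<ℓus (ℕ.≤-trans (ℓ-minimal _ (≈trans w≃us (++-congʳ [ s ] (reduced≃ u))))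
                                                               (ℕ.≤-trans (ℕ.<⇒≤ w<u) (ℕ.≤-reflexive (length-reduced u))))))

  ℓ-descent⇒nonpos : ∀ u s → ℓ (u ++ [ s ]) < ℓ u → NonposV (act u (e s))
  ℓ-descent⇒nonpos u s ℓus<ℓu = from (nonneg-or-shortens v s)
    where
    v = reduced (u ++ [ s ])
    v·s≃u : v ++ [ s ] ≃ u
    v·s≃u = ≈trans (++-congʳ [ s ] (reduced≃ _)) (++-[s]-[s] u s)
    from : NonnegOrShortens v s → NonposV (act u (e s))
    from (inj₁ ≥0) = NonposV-resp (≋-trans (≋-sym (act-e-last v s)) (act-resp v·s≃u (e s))) (λ t → Nonneg-resp (sym (-‿involutive _)) (≥0 t))
    from (inj₂ (w , w≃vs , w<v)) =
      ⊥-elim (ℕ.<-irrefl ≡.refl (ℕ.<-≤-trans ℓus<ℓu (ℕ.≤-trans (ℓ-minimal u (≈trans w≃vs v·s≃u))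
                                                                 (ℕ.≤-trans (ℕ.<⇒≤ w<v) (ℕ.≤-reflexive (length-reduced _))))))

  root-nonzero : ∀ u s → NonnegV (act u (e s)) → NonposV (act u (e s)) → ⊥
  root-nonzero u s ≥0 ≤0 = 1≉0 (trans (sym (e-diag s)) (e-s≋𝟘 s))
    where
    e-s≋𝟘 : e s ≋ 𝟘
    e-s≋𝟘 = ≋-trans (≋-sym (act-reverse-act u (e s)))
                    (≋-trans (act-cong (reverse u) (λ t → nonneg-antisym (≥0 t) (≤0 t))) (act-𝟘 (reverse u)))

module CoxeterAutomorphism {n : ℕ} (M : CoxeterMatrix n) (θ : Word n → Word n) (aut : IsAutomorphism M θ)
                           (θ-involutive : ∀ u → M ⊢ θ (θ u) ≈ u) (θ-preservesS : PreservesS M θ) where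
  open CoxeterWords M
  open IsAutomorphism aut

  π : Fin n → Fin n
  π s = proj₁ (proj₁ θ-preservesS s)

  θ[s]≃[πs] : ∀ s → θ [ s ] ≃ [ π s ]
  θ[s]≃[πs] s = proj₂ (proj₁ θ-preservesS s)

  θ[πs]≃[s] : ∀ s → θ [ π s ] ≃ [ s ]
  θ[πs]≃[s] s = ≈trans (cong-θ (≈sym (θ[s]≃[πs] s))) (θ-involutive [ s ])

  θ[]≃[] : θ [] ≃ []
  θ[]≃[] = ≈sym (++-cancelˡ (θ []) (≈trans (≃-reflexive (++-identityʳ (θ []))) (hom [] [])))

  θ≃map-π : ∀ u → θ u ≃ map π u
  θ≃map-π [] = θ[]≃[]
  θ≃map-π (s ∷ u) = ≈trans (hom [ s ] u) (++-cong (θ[s]≃[πs] s) (θ≃map-π u))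

  θ-∷ʳ : ∀ u s → θ (u ++ [ s ]) ≃ θ u ++ [ π s ]
  θ-∷ʳ u s = ≈trans (hom u [ s ]) (++-congˡ (θ u) (θ[s]≃[πs] s))

  θ-reverse : ∀ u → θ (reverse u) ≃ reverse (θ u)
  θ-reverse u = ≈trans (θ≃map-π (reverse u)) (≈trans (≃-reflexive (reverse-map π u)) (reverse-cong (≈sym (θ≃map-π u))))


module TwistedInvolutions {n : ℕ} (M : CoxeterMatrix n) (K : ConeRing) (cos : CoxeterCosines M K)
                          (θ : Word n → Word n) (aut : IsAutomorphism M θ)
                          (θ-involutive : ∀ u → M ⊢ θ (θ u) ≈ u) (θ-preservesS : PreservesS M θ) where
  open ConeRing K hiding (zero)
  open CoxeterWords M
  open GeometricRepresentation M K cos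
  open RootPositivity M K cos
  open WordProblem M K cos
  open CoxeterAutomorphism M θ aut θ-involutive θ-preservesS
  open IsAutomorphism aut
  open import Algebra.Properties.Ring ring using (-‿involutive; -‿distribˡ-*; -‿distribʳ-*; -0#≈0#)

  ℓ-θ : ∀ u → ℓ (θ u) ≡ ℓ u
  ℓ-θ = ℓ-invariant θ θ-involutive ℓ-θ-≤
    where
    ℓ-θ-≤ : ∀ u → ℓ (θ u) ≤ ℓ u
    ℓ-θ-≤ u = ℕ.≤-trans (ℓ-minimal (θ u) (≈trans (≈sym (θ≃map-π (reduced u))) (cong-θ (reduced≃ u))))
                        (ℕ.≤-reflexive (≡.trans (length-map π (reduced u)) (length-reduced u)))

  ℓ-θ-∷ʳ : ∀ u s → ℓ (θ u ++ [ π s ]) ≡ ℓ (u ++ [ s ])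
  ℓ-θ-∷ʳ u s = ≡.trans (ℓ-cong (≈sym (θ-∷ʳ u s))) (ℓ-θ (u ++ [ s ]))

  θ-root-same-sign : ∀ u s → (NonnegV (act u (e s)) × NonnegV (act (θ u) (e (π s))))
                           ⊎ (NonposV (act u (e s)) × NonposV (act (θ u) (e (π s))))
  θ-root-same-sign u s with ℓ-∷ʳ u s
  ... | inj₁ ℓus≡ℓu+1 =
    inj₁ (ℓ-ascent⇒nonneg u s ascent , ℓ-ascent⇒nonneg (θ u) (π s) (≡.subst₂ _<_ (≡.sym (ℓ-θ u)) (≡.sym (ℓ-θ-∷ʳ u s)) ascent))
    where ascent = ℕ.≤-reflexive (≡.sym ℓus≡ℓu+1)
  ... | inj₂ ℓus+1≡ℓu =
    inj₂ (ℓ-descent⇒nonpos u s descent , ℓ-descent⇒nonpos (θ u) (π s) (≡.subst₂ _<_ (≡.sym (ℓ-θ-∷ʳ u s)) (≡.sym (ℓ-θ u)) descent))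
    where descent = ℕ.≤-reflexive ℓus+1≡ℓu

  θ-root-not-nonpos-multiple : ∀ u s μ → Nonneg (- μ) → act (θ u) (e (π s)) ≋ μ • act u (e s) → ⊥
  θ-root-not-nonpos-multiple u s μ -μ≥0 θu≋μu with θ-root-same-sign u s
  ... | inj₁ (u≥0 , θu≥0) = root-nonzero (θ u) (π s) θu≥0 (NonposV-resp (≋-sym θu≋μu) μu≤0)
    where
    μu≤0 : NonposV (μ • act u (e s))
    μu≤0 t = Nonneg-resp (sym (-‿distribˡ-* μ _)) (*-nonneg -μ≥0 (u≥0 t))
  ... | inj₂ (u≤0 , θu≤0) = root-nonzero (θ u) (π s) (NonnegV-resp (≋-sym θu≋μu) μu≥0) θu≤0
    where
    μu≥0 : NonnegV (μ • act u (e s))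
    μu≥0 t = Nonneg-resp (trans (sym (-‿distribˡ-* μ _)) (trans (-‿cong (sym (-‿distribʳ-* μ _))) (-‿involutive _)))
                         (*-nonneg -μ≥0 (u≤0 t))

  σ-nonneg-nonpos⇒multiple : ∀ s {x} → NonnegV x → NonposV (σ s x) → σ s x ≋ σ s x s • e s
  σ-nonneg-nonpos⇒multiple s {x} x≥0 σx≤0 t = by-cases (s Fin.≟ t)
    where
    by-cases : Dec (s ≡ t) → σ s x t ≈ σ s x s * e s t
    by-cases (yes ≡.refl) = sym (trans (*-congˡ (e-diag s)) (*-identityʳ _))
    by-cases (no s≢t) = trans σx≈x (trans (nonneg-antisym (x≥0 t) (Nonneg-resp (-‿cong σx≈x) (σx≤0 t)))
                                          (sym (trans (*-congˡ (e-offdiag s≢t)) (zeroʳ _))))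
      where
      σx≈x : σ s x t ≈ x t
      σx≈x = trans (+-congˡ (trans (-‿cong (trans (*-congˡ (e-offdiag s≢t)) (zeroʳ _))) -0#≈0#)) (+-identityʳ _)

  IsTwisted : Word n → Word n → Set
  IsTwisted w y = w ≃ y ++ θ (reverse y)

  θ-twisted : ∀ {w y} → IsTwisted w y → θ w ≃ reverse w
  θ-twisted {w} {y} tw =
    ≈trans (cong-θ tw) (≈trans (hom y _) (≈trans (++-congˡ (θ y) (θ-involutive (reverse y)))
    (≈sym (≈trans (reverse-cong tw) (≈trans (≃-reflexive (reverse-++ y (θ (reverse y))))
                                           (++-congʳ (reverse y) reverse-θ-reverse))))))
    where
    reverse-θ-reverse : reverse (θ (reverse y)) ≃ θ y
    reverse-θ-reverse = ≈trans (≈sym (θ-reverse (reverse y))) (≃-reflexive (≡.cong θ (reverse-involutive y)))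

  twisted-conj : ∀ s {w y} → IsTwisted w y → IsTwisted (s ∷ (w ++ [ π s ])) (s ∷ y)
  twisted-conj s {w} {y} tw =
    ∷-cong s (≈trans (++-congʳ [ π s ] tw)
             (≈trans (≃-reflexive (++-assoc y (θ (reverse y)) [ π s ]))
             (≈trans (++-congˡ y (≈sym (θ-∷ʳ (reverse y) s)))
                     (≃-reflexive (≡.cong (λ z → y ++ θ z) (≡.sym (unfold-reverse s y)))))))

  conj-conj : ∀ s w → w ≃ s ∷ ((s ∷ (w ++ [ π s ])) ++ [ π s ])
  conj-conj s w = ≈sym (≈trans (ss-cancel [] _ s) (++-[s]-[s] w (π s)))

  ℓ-twisted-≤ : ∀ {w x} → IsTwisted w x → ℓ w ≤ 2 ℕ.* ℓ x
  ℓ-twisted-≤ {w} {x} tw = ℕ.≤-trans (ℓ-≤ (≈sym tw)) (ℕ.≤-trans (ℓ-++-≤ x _)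
                             (ℕ.≤-reflexive (≡.cong (ℓ x ℕ.+_) (≡.trans (ℓ-θ (reverse x)) (≡.trans (ℓ-reverse x) (≡.sym (ℕ.+-identityʳ (ℓ x))))))))

  -- Otherwise w α_{π s} = μ α_s with μ ≤ 0, so θ(y⁻¹) α_{π s} = μ y⁻¹ α_s, which
  -- θ-root-not-nonpos-multiple forbids.
  twisted-descent : ∀ s {w y} → IsTwisted w y → ℓ (s ∷ w) < ℓ w → suc (ℓ (s ∷ (w ++ [ π s ]))) ≡ ℓ (s ∷ w)
  twisted-descent s {w} {y} tw sw<w with ℓ-∷ʳ (s ∷ w) (π s)
  ... | inj₂ swπs<sw = swπs<sw
  ... | inj₁ sw<swπs = ⊥-elim (θ-root-not-nonpos-multiple (reverse y) s μ -μ≥0 θy⁻¹-root≋μ•y⁻¹-root)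
    where
    ℓwπs≡ℓsw : ℓ (w ++ [ π s ]) ≡ ℓ (s ∷ w)
    ℓwπs≡ℓsw = begin
      ℓ (w ++ [ π s ])            ≡⟨ ℓ-θ _ ⟨
      ℓ (θ (w ++ [ π s ]))        ≡⟨ ℓ-cong (≈trans (hom w [ π s ]) (++-cong (θ-twisted tw) (θ[πs]≃[s] s))) ⟩
      ℓ (reverse w ++ [ s ])      ≡⟨ ≡.cong ℓ (unfold-reverse s w) ⟨
      ℓ (reverse (s ∷ w))         ≡⟨ ℓ-reverse (s ∷ w) ⟩
      ℓ (s ∷ w)                   ∎
      where open ≡.≡-Reasoning
    sw-root≥0 : NonnegV (act (s ∷ w) (e (π s)))
    sw-root≥0 = ℓ-ascent⇒nonneg (s ∷ w) (π s) (ℕ.≤-reflexive (≡.sym sw<swπs))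
    w-root≤0 : NonposV (act w (e (π s)))
    w-root≤0 = ℓ-descent⇒nonpos w (π s) (≡.subst (_< ℓ w) (≡.sym ℓwπs≡ℓsw) sw<w)
    w-root≋σ : act w (e (π s)) ≋ σ s (act (s ∷ w) (e (π s)))
    w-root≋σ = act-resp (≈sym (ss-cancel [] w s)) (e (π s))
    μ : Carrier
    μ = σ s (act (s ∷ w) (e (π s))) s
    -μ≥0 : Nonneg (- μ)
    -μ≥0 = NonposV-resp w-root≋σ w-root≤0 s
    w-root≋μ•e : act w (e (π s)) ≋ μ • e s
    w-root≋μ•e = ≋-trans w-root≋σ (σ-nonneg-nonpos⇒multiple s sw-root≥0 (NonposV-resp w-root≋σ w-root≤0))
    θy⁻¹-root≋μ•y⁻¹-root : act (θ (reverse y)) (e (π s)) ≋ μ • act (reverse y) (e s)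
    θy⁻¹-root≋μ•y⁻¹-root =
      ≋-trans (≋-sym (act-reverse-act y _))
              (≋-trans (act-cong (reverse y) (≋-trans (≋-reflexive (≡.sym (act-++ y (θ (reverse y)) (e (π s)))))
                                                      (≋-trans (act-resp (≈sym tw) (e (π s))) w-root≋μ•e)))
                       (act-• (reverse y) μ (e s)))

  twisted-half-length-≤ : ∀ N {w y} → ℓ w ≤ N → IsTwisted w y → ∃ λ x → IsTwisted w x × ℓ w ≡ 2 ℕ.* ℓ x
  twisted-half-length-≤ N {w} {y} ℓw≤N tw = from-reduced (reduced w) (reduced≃ w) (length-reduced w)
    where
    from-reduced : ∀ r → r ≃ w → length r ≡ ℓ w → ∃ λ x → IsTwisted w x × ℓ w ≡ 2 ℕ.* ℓ x
    from-reduced [] []≃w 0≡ℓw = [] , ≈trans (≈sym []≃w) (≈sym θ[]≃[]) , ≡.trans (≡.sym 0≡ℓw) (≡.cong (2 ℕ.*_) (≡.sym ℓ-[]))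
    from-reduced (s ∷ w′) r≃w 1+w′≡ℓw = by-fuel N ℓw≤N
      where
      sw<w : ℓ (s ∷ w) < ℓ w
      sw<w = ℕ.≤-trans (s≤s (ℓ-minimal (s ∷ w) (≈sym (≈trans (∷-cong s (≈sym r≃w)) (ss-cancel [] w′ s))))) (ℕ.≤-reflexive 1+w′≡ℓw)
      w₂ = s ∷ (w ++ [ π s ])
      ℓw≡ℓw₂+2 : ℓ w ≡ suc (suc (ℓ w₂))
      ℓw≡ℓw₂+2 = ≡.trans (ℕ.≤-antisym (ℕ.≤-trans (ℓ-≤ (ss-cancel [] w s)) (ℓ-∷-≤ s (s ∷ w))) sw<w)
                         (≡.cong suc (≡.sym (twisted-descent s tw sw<w)))
      extend : (∃ λ x′ → IsTwisted w₂ x′ × ℓ w₂ ≡ 2 ℕ.* ℓ x′) → ∃ λ x → IsTwisted w x × ℓ w ≡ 2 ℕ.* ℓ x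
      extend (x′ , tw₂ , ℓw₂≡2ℓx′) = s ∷ x′ , ≈trans (conj-conj s w) (twisted-conj s tw₂) , ℓw≡2ℓx
        where
        ℓw≡2[ℓx′+1] : ℓ w ≡ 2 ℕ.* suc (ℓ x′)
        ℓw≡2[ℓx′+1] = ≡.trans ℓw≡ℓw₂+2 (≡.trans (≡.cong (suc ∘ suc) ℓw₂≡2ℓx′) (≡.sym (ℕ.*-suc 2 (ℓ x′))))
        ℓx≡ℓx′+1 : ℓ (s ∷ x′) ≡ suc (ℓ x′)
        ℓx≡ℓx′+1 = ℕ.≤-antisym (ℓ-∷-≤ s x′) (ℕ.*-cancelˡ-≤ 2 (ℕ.≤-trans (ℕ.≤-reflexive (≡.sym ℓw≡2[ℓx′+1]))
                                                                 (ℓ-twisted-≤ (≈trans (conj-conj s w) (twisted-conj s tw₂)))))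
        ℓw≡2ℓx : ℓ w ≡ 2 ℕ.* ℓ (s ∷ x′)
        ℓw≡2ℓx = ≡.trans ℓw≡2[ℓx′+1] (≡.cong (2 ℕ.*_) (≡.sym ℓx≡ℓx′+1))
      by-fuel : ∀ N → ℓ w ≤ N → ∃ λ x → IsTwisted w x × ℓ w ≡ 2 ℕ.* ℓ x
      by-fuel zero ℓw≤0 = ⊥-elim (ℕ.n≮0 (ℕ.<-≤-trans sw<w ℓw≤0))
      by-fuel (suc N′) ℓw≤N′+1 =
        extend (twisted-half-length-≤ N′ (ℕ.≤-pred (ℕ.≤-trans (ℕ.≤-trans (ℕ.n≤1+n _) (ℕ.≤-reflexive (≡.sym ℓw≡ℓw₂+2))) ℓw≤N′+1))
                                      (twisted-conj s tw))

  twisted-half-length : ∀ {w y} → IsTwisted w y → ∃ λ x → IsTwisted w x × ℓ w ≡ 2 ℕ.* ℓ x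
  twisted-half-length {w} = twisted-half-length-≤ (ℓ w) ℕ.≤-refl

sup : ∀ {k} → (Fin k → ℕ) → ℕ
sup {zero} f = 0
sup {suc k} f = f Fin.zero ⊔ sup (λ i → f (Fin.suc i))

≤-sup : ∀ {k} (f : Fin k → ℕ) i → f i ≤ sup f
≤-sup f Fin.zero = ℕ.m≤m⊔n _ _
≤-sup f (Fin.suc i) = ℕ.≤-trans (≤-sup (λ j → f (Fin.suc j)) i) (ℕ.m≤n⊔m _ _)

module _ {n : ℕ} (M : CoxeterMatrix n) where
  open CoxeterMatrix M

  maxOrder : ℕ
  maxOrder = sup (λ s → sup (m s))

  m≤maxOrder : ∀ s t → m s t ≤ maxOrder
  m≤maxOrder s t = ℕ.≤-trans (≤-sup (m s) t) (≤-sup (λ s′ → sup (m s′)) s)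

  towerCosines : CoxeterCosines M (tower maxOrder)
  towerCosines = record
    { twoCos = twoCos′
    ; twoCos-∞ = refl
    ; twoCos-1 = refl
    ; twoCos-m = λ s t 2≤m → twoCos′-isTwoCosPiOver (m s t) 2≤m (ℕ.m≤n⇒m≤1+n (m≤maxOrder s t))
    }
    where
    open ConeRing (tower maxOrder)
    twoCos′ : ℕ → Carrier
    twoCos′ zero = 1# + 1#
    twoCos′ (suc zero) = - (1# + 1#)
    twoCos′ k@(suc (suc _)) = towerTwoCos maxOrder k
    twoCos′-isTwoCosPiOver : ∀ k → 2 ≤ k → k ≤ suc maxOrder → IsTwoCosPiOver (tower maxOrder) k (twoCos′ k)
    twoCos′-isTwoCosPiOver (suc zero) (ℕ.s≤s ()) _
    twoCos′-isTwoCosPiOver k@(suc (suc _)) 2≤k k≤N+1 = towerTwoCos-isTwoCosPiOver maxOrder k 2≤k k≤N+1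

open import Data.Nat using (_*_)

lemma4p9 : ∀ {n : ℕ} (M : CoxeterMatrix n) (θ : Word n → Word n)
    → IsAutomorphism M θ
    → (∀ u → M ⊢ θ (θ u) ≈ u)
    → PreservesS M θ
    → ∀ (w y : Word n) → M ⊢ w ≈ (y ++ θ (inv y))
    → ∃ λ (x : Word n) → (M ⊢ w ≈ (x ++ θ (inv x)))
    × (∃ λ (k : ℕ) → IsLength M x k × IsLength M w (2 * k))
lemma4p9 M θ aut θ-involutive θ-preservesS w y w≃yθy⁻¹ =
  let x , w≃xθx⁻¹ , ℓw≡2ℓx = twisted-half-length w≃yθy⁻¹
  in x , w≃xθx⁻¹ , ℓ x , proj₂ (ℓ-isLength x) , ≡.subst (IsLength M w) ℓw≡2ℓx (proj₂ (ℓ-isLength w))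
  where
  open WordProblem M (tower (maxOrder M)) (towerCosines M)
  open TwistedInvolutions M (tower (maxOrder M)) (towerCosines M) θ aut θ-involutive θ-preservesS
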